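{- Let $\mathbb{G}$ be a ribbon graph, let $(X,Y,Z)\in \mathcal Q(\mathbb{G})$ and let $B:=T(X,Y,Z)$. Then distinct edges $e$ and $f$ of $\mathbb{G}$ are $(X,Y,Z)$-interlaced if and only if $C(B,\omega_e)$ meets $\omega_f$. Consequently, for a total ordering $\prec$ of the edges (and the induced ordering of skew classes, $\omega_e\prec\omega_f$ iff $e\prec f$), an edge $e$ is active with respect to $(X,Y,Z)$ if and only if $\omega_e$ is active with respect to $B$ in $Z(\mathbb G)$.
   Context: A ribbon graph $\mathbb G=(V,E)$ is a surface with boundary given as a union of discs, vertices and edges, meeting in disjoint line segments each on the boundary of one vertex and one edge, each edge containing exactly two such segments. $b(\cdot)$ counts boundary components, $k(\cdot)$ connected components; $\mathbb G\setminus Y$ deletes edges in $Y$; the partial Petrial $\mathbb G^{\tau(Z)}$ detaches one end of each $e\in Z$ and reattaches it with a half-twist. $\mathcal Q(\mathbb G)$ is the set of ordered partitions $(X,Y,Z)$ of $E$ into three possibly empty blocks with $b(\mathbb G^{\tau(Z)}\setminus Y)=k(\mathbb G)$. For such $(X,Y,Z)$, for each component of $\mathbb G$ the corresponding boundary component of $\mathbb G^{\tau(Z)}\setminus Y$ defines a curve $\partial$ in $\mathbb G^{\tau(Z)}$ meeting each edge of that component in exactly two arcs; edges $e,f$ are $(X,Y,Z)$-interlaced if travelling around $\partial$ they are met in cyclic order $efef$. An edge $e$ is active w.r.t. $(X,Y,Z)$ if it is not $(X,Y,Z)$-interlaced with any edge $f\prec e$. $T(X,Y,Z)=\{\dot e:e\in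 X\}\cup\{\bar e:e\in Y\}\cup\{\hat e:e\in Z\}$, and $Z(\mathbb G)$ is the (tight) $3$-matroid on $\{\dot e,\bar e,\hat e:e\in E\}$ with skew classes $\omega_e=\{\dot e,\bar e,\hat e\}$ and bases $T(X,Y,Z)$, $(X,Y,Z)\in\mathcal Q(\mathbb G)$. In a multimatroid, circuits are minimal subtransversals $S$ with rank less than $|S|$ (rank $r(S)=\max_B|B\cap S|$); for a basis $B$ and skew class $\omega$, $B\cup\omega$ contains at most one circuit, the fundamental circuit $C(B,\omega)$ (which always exists for tight multimatroids). With an order $\prec$ on skew classes, inducing an order on subtransversals with least element $\min$, $\omega$ is active w.r.t. a basis $B$ if $C(B,\omega)$ exists and $\min C(B,\omega)\in\omega$. -}

module Defs where

open import Level using (0ℓ)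
open import Data.Nat using (ℕ; zero; suc; _≤_; _<_)
open import Data.Nat.DivMod using (_mod_)
open import Data.Fin using (Fin; zero; suc; toℕ) renaming (_<_ to _<ᶠ_)
open import Data.Bool using (Bool; true; false; _xor_; if_then_else_)
open import Data.Maybe using (Maybe; just; nothing)
open import Data.Product using (Σ; ∃; _×_; _,_; proj₁; proj₂)
open import Data.Sum using (_⊎_; inj₁; inj₂)
open import Data.Empty using (⊥)
open import Relation.Nullary using (¬_)
open import Relation.Binary.Core using (Rel)
open import Relation.Binary.PropositionalEquality using (_≡_; _≢_)
open import Relation.Binary.Construct.Closure.Equivalence using (EqClosure)
open import Function.Bundles using (_⇔_)

iter : {A : Set} → (A → A) → ℕ → A → A
iter f zero    x = x
iter f (suc n) x = f (iter f n x)

count : {m : ℕ} → (Fin m → Bool) → ℕ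
count {zero}  P = 0
count {suc m} P = (if P zero then 1 else 0) Data.Nat.+ count (λ i → P (suc i))

other : Fin 2 → Fin 2
other zero       = suc zero
other (suc zero) = zero

csuc : {n : ℕ} → Fin (suc n) → Fin (suc n)
csuc {n} i = suc (toℕ i) mod (suc n)

-- "the equivalence closure of R has exactly n classes":
-- a surjection onto Fin n whose fibres are exactly the classes
NumClasses : {A : Set} → Rel A 0ℓ → ℕ → Set
NumClasses {A} R n =
  Σ (A → Fin n) λ f →
    (∀ (y : Fin n) → ∃ λ x → f x ≡ y) ×
    (∀ x y → (f x ≡ f y) ⇔ EqClosure R x y)

-- Ribbon graphs as signed rotation systems.
-- An edge end ("half-edge") is (e , j), j ∈ Fin 2.  Each end is attached
-- to a vertex along a segment; the two endpoints of that segment are the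
-- corners (h , 0), (h , 1), where (w.r.t. the chosen local orientation of
-- the vertex disc) going around the vertex boundary one meets
-- (h , 0), the segment of h, (h , 1), then the arc to (succ h , 0).
-- succ is the cyclic rotation of the ends around each vertex.
-- An untwisted edge e has sides joining ((e,0),0)-((e,1),1) and
-- ((e,0),1)-((e,1),0); a twisted one ((e,0),j)-((e,1),j).

End : ℕ → Set
End m = Fin m × Fin 2

Corner : ℕ → Set
Corner m = End m × Fin 2

record RibbonGraph : Set where
  field
    nV nE       : ℕ
    vertexOf    : End nE → Fin nV
    succ        : End nE → End nE
    pred        : End nE → End nE
    succ-pred   : ∀ h → succ (pred h) ≡ h
    pred-succ   : ∀ h → pred (succ h) ≡ h
    succ-vertex : ∀ h → vertexOf (succ h) ≡ vertexOf h
    succ-trans  : ∀ h h' → vertexOf h ≡ vertexOf h' → ∃ λ n → iter succ n h ≡ h'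
    twist       : Fin nE → Bool

open RibbonGraph public

-- blocks of an ordered partition (X , Y , Z); also the three elements
-- dot (X), bar (Y), hat (Z) of a skew class
data Block : Set where
  inX inY inZ : Block

isZ : Block → Bool
isZ inZ = true
isZ _   = false

eqB : Block → Block → Bool
eqB inX inX = true
eqB inY inY = true
eqB inZ inZ = true
eqB _   _   = false

-- an ordered partition (X,Y,Z) of E, equivalently the transversal T(X,Y,Z)
Partition : RibbonGraph → Set
Partition G = Fin (nE G) → Block

module _ (G : RibbonGraph) (p : Partition G) where

  -- arcs of the boundary curve ∂ of G^{τ(Z)} \ Y, seen in G^{τ(Z)}:
  -- inj₁ h       : vertex-boundary arc from (h,1) to (succ h,0)
  -- inj₂ (e , j) : if e ∈ Y, the attachment segment of end (e,j);
  --                otherwise the j-th side of the edge e in G^{τ(Z)}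
  Arc : Set
  Arc = End (nE G) ⊎ (Fin (nE G) × Fin 2)

  sideEnds : Bool → Fin (nE G) → Fin 2 → Corner (nE G) × Corner (nE G)
  sideEnds true  e j = ((e , zero) , j) , ((e , suc zero) , j)
  sideEnds false e j = ((e , zero) , j) , ((e , suc zero) , other j)

  edgeArcEnds : Block → Fin (nE G) → Fin 2 → Corner (nE G) × Corner (nE G)
  edgeArcEnds inY e j = ((e , j) , zero) , ((e , j) , suc zero)
  edgeArcEnds b   e j = sideEnds (twist G e xor isZ b) e j

  arcEnds : Arc → Corner (nE G) × Corner (nE G)
  arcEnds (inj₁ h)       = (h , suc zero) , (succ G h , zero)
  arcEnds (inj₂ (e , j)) = edgeArcEnds (p e) e j

  label : Arc → Maybe (Fin (nE G))
  label (inj₁ _)       = nothing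
  label (inj₂ (e , _)) = just e

  Joins : Arc → Corner (nE G) → Corner (nE G) → Set
  Joins a c c' = (arcEnds a ≡ (c , c')) ⊎ (arcEnds a ≡ (c' , c))

  -- points of the boundary of G^{τ(Z)} \ Y: corners, and vertices with no ends
  BPoint : Set
  BPoint = Corner (nE G) ⊎ Σ (Fin (nV G)) (λ v → ∀ h → vertexOf G h ≢ v)

  BAdj : Rel BPoint 0ℓ
  BAdj (inj₁ c) (inj₁ c') = Σ Arc λ a → arcEnds a ≡ (c , c')
  BAdj _        _         = ⊥

  -- a closed curve: a cyclic sequence of pairwise distinct boundary arcs,
  -- consecutive ones sharing a corner (i.e. a boundary component)
  record ClosedTrail : Set where
    field
      len     : ℕ
      arc     : Fin (suc len) → Arc
      corner  : Fin (suc len) → Corner (nE G)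
      arc-inj : ∀ i j → arc i ≡ arc j → i ≡ j
      joins   : ∀ i → Joins (arc i) (corner i) (corner (csuc i))

  Interlaced : Fin (nE G) → Fin (nE G) → Set
  Interlaced e f =
    Σ ClosedTrail λ T →
      let open ClosedTrail T
          lab = λ i → label (arc i) in
      ∃ λ i → ∃ λ j → ∃ λ k → ∃ λ l →
        i <ᶠ j × j <ᶠ k × k <ᶠ l ×
        ((lab i ≡ just e × lab j ≡ just f × lab k ≡ just e × lab l ≡ just f) ⊎
         (lab i ≡ just f × lab j ≡ just e × lab k ≡ just f × lab l ≡ just e))

  EdgeActive : Rel (Fin (nE G)) 0ℓ → Fin (nE G) → Set
  EdgeActive _≺_ e = ∀ f → f ≺ e → ¬ Interlaced e f

GAdj : (G : RibbonGraph) → Rel (Fin (nV G)) 0ℓ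
GAdj G u v = Σ (Fin (nE G)) λ e →
  vertexOf G (e , zero) ≡ u × vertexOf G (e , suc zero) ≡ v

-- (X,Y,Z) ∈ Q(G) :  b(G^{τ(Z)} \ Y) = k(G)
InQ : (G : RibbonGraph) → Partition G → Set
InQ G p = Σ ℕ λ n → NumClasses (BAdj G p) n × NumClasses (GAdj G) n

-- Multimatroids over skew classes ω_e = {(e,inX),(e,inY),(e,inZ)}, e ∈ Fin m,
-- given by a predicate on transversals saying which are bases.

module MM {m : ℕ} (IsBasis : (Fin m → Block) → Set) where

  Transversal : Set
  Transversal = Fin m → Block

  Subtransversal : Set
  Subtransversal = Fin m → Maybe Block

  memB : Maybe Block → Block → Bool
  memB nothing  _ = false
  memB (just a) b = eqB a b

  isJust : Maybe Block → Bool
  isJust nothing  = false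
  isJust (just _) = true

  size : Subtransversal → ℕ
  size S = count (λ f → isJust (S f))

  meet : Transversal → Subtransversal → ℕ
  meet B S = count (λ f → memB (S f) (B f))

  IsRank : Subtransversal → ℕ → Set
  IsRank S r = (Σ Transversal λ B → IsBasis B × meet B S ≡ r) ×
               (∀ B → IsBasis B → meet B S ≤ r)

  Dependent : Subtransversal → Set
  Dependent S = Σ ℕ λ r → IsRank S r × r < size S

  _⊆_ : Subtransversal → Subtransversal → Set
  S ⊆ S' = ∀ f b → S f ≡ just b → S' f ≡ just b

  IsCircuit : Subtransversal → Set
  IsCircuit C = Dependent C × (∀ S → S ⊆ C → Dependent S → C ⊆ S)

  InBω : Transversal → Fin m → Subtransversal → Set
  InBω B e C = ∀ f b → C f ≡ just b → (f ≡ e) ⊎ (b ≡ B f)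

  IsFundCircuit : Transversal → Fin m → Subtransversal → Set
  IsFundCircuit B e C = IsCircuit C × InBω B e C

  FundCircuitMeets : Transversal → Fin m → Fin m → Set
  FundCircuitMeets B e f =
    Σ Subtransversal λ C → IsFundCircuit B e C × ∃ λ b → C f ≡ just b

  ClassActive : Rel (Fin m) 0ℓ → Transversal → Fin m → Set
  ClassActive _≺_ B e =
    Σ Subtransversal λ C → IsFundCircuit B e C ×
      (∃ λ b → C e ≡ just b) ×
      (∀ f b → C f ≡ just b → (f ≡ e) ⊎ (e ≺ f))

module ZG (G : RibbonGraph) = MM {nE G} (InQ G)

-- Fix the basis B = T(X, Y, Z) and an edge e.  The component of e in G^τ(Z) \ Y has a
-- single boundary curve, and it passes e twice.  Of the two other ways of re-gluing e,
-- one keeps a single curve (so gives another basis), while the other cuts off the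
-- segment between the two passes, so that no basis contains it together with B on the
-- edges f passed once inside and once outside that segment, i.e. interlaced with e;
-- switching any one such f reconnects the pieces.  Hence C(B, ω_e) consists of the
-- cutting element of ω_e and the elements of B on the edges interlaced with e, which
-- gives both the characterisation of interlacing and the comparison of activities.

module Submission where

open import Defs
open import Level using (0ℓ)
open import Data.Fin using (Fin)
open import Data.Product using (_×_)
open import Relation.Binary.Core using (Rel)
open import Relation.Binary.Structures using (IsStrictTotalOrder)
open import Relation.Binary.PropositionalEquality using (_≡_; _≢_)
open import Function.Bundles using (_⇔_)

open import Algebra.Properties.CommutativeSemigroup using (interchange)
open import Data.Bool using (Bool; true; false; _xor_; if_then_else_)
open import Data.Empty using (⊥; ⊥-elim)
open import Data.Fin using (zero; suc; toℕ; fromℕ<; punchOut; combine)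
open import Data.Fin.Properties as FP
  using (toℕ-injective; toℕ-fromℕ<; toℕ<n; punchOut-injective; injective⇒≤; any?; combine-injective; pigeonhole)
open import Data.Maybe using (Maybe; just; nothing)
open import Data.Maybe.Properties as MaybeP using (just-injective)
open import Data.Nat as ℕ using (ℕ; zero; suc; _+_; _∸_; _≤_; _<_; _<?_; _≤?_; z≤n; s≤s)
open import Data.Nat.DivMod using (_%_; %-distribˡ-+; m%n%n≡m%n; [m+n]%n≡m%n; m<n⇒m%n≡m; m%n<n; n%n≡0; m≤n⇒[n∸m]%m≡n%m)
open import Data.Nat.Induction using (<-rec)
open import Data.Nat.Properties
open import Data.Product using (∃; _,_; proj₁; proj₂)
open import Data.Product.Properties as PP using ()
open import Data.Sum using (_⊎_; inj₁; inj₂; [_,_]′)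
open import Function.Base using (_∘_)
open import Function.Bundles using (Equivalence; mk⇔)
open import Function.Definitions using (Injective)
open import Relation.Binary.Construct.Closure.Equivalence as EqC using (EqClosure)
open import Relation.Binary.Construct.Closure.ReflexiveTransitive using (ε; _◅_; _◅◅_)
open import Relation.Binary.Construct.Closure.Symmetric using (fwd; bwd)
open import Relation.Binary.Definitions using (Decidable; DecidableEquality; tri<; tri≈; tri>)
open import Relation.Binary.PropositionalEquality
  using (refl; sym; trans; cong; cong₂; subst; subst₂; module ≡-Reasoning)
open import Relation.Nullary using (¬_; Dec; yes; no; _×-dec_)

endo-injective⇒surjective : ∀ {m} (h : Fin m → Fin m) → Injective _≡_ _≡_ h →
  ∀ y → ∃ λ x → h x ≡ y
endo-injective⇒surjective {suc m} h h-inj y with any? (λ x → h x FP.≟ y)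
... | yes hit = hit
... | no miss = ⊥-elim (<-irrefl refl (injective⇒≤ {f = squeeze} squeeze-inj))
  where
    squeeze : Fin (suc m) → Fin m
    squeeze x = punchOut {i = y} {j = h x} (λ eq → miss (x , sym eq))
    squeeze-inj : Injective _≡_ _≡_ squeeze
    squeeze-inj {x} {x′} eq =
      h-inj (punchOut-injective {i = y} (λ e → miss (x , sym e)) (λ e → miss (x′ , sym e)) eq)

endo-surjective⇒injective : ∀ {m} (h : Fin m → Fin m) → (∀ y → ∃ λ x → h x ≡ y) →
  Injective _≡_ _≡_ h
endo-surjective⇒injective {m} h h-surj {a} {b} ha≡hb =
  trans (sym (section∘h a)) (trans (cong section ha≡hb) (section∘h b))
  where
    section : Fin m → Fin m
    section y = proj₁ (h-surj y)
    h∘section : ∀ y → h (section y) ≡ y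
    h∘section y = proj₂ (h-surj y)
    section-inj : Injective _≡_ _≡_ section
    section-inj {y} {y′} eq = trans (sym (h∘section y)) (trans (cong h eq) (h∘section y′))
    section∘h : ∀ a → section (h a) ≡ a
    section∘h a with endo-injective⇒surjective section section-inj a
    ... | y , y↦a = trans (cong (λ x → section (h x)) (sym y↦a)) (trans (cong section (h∘section y)) y↦a)

iter-+ : ∀ {A : Set} (f : A → A) m n x → iter f (m + n) x ≡ iter f m (iter f n x)
iter-+ f zero    n x = refl
iter-+ f (suc m) n x = cong f (iter-+ f m n x)

iter-commute : ∀ {A : Set} (f : A → A) n x → iter f n (f x) ≡ f (iter f n x)
iter-commute f zero    x = refl
iter-commute f (suc n) x = cong f (iter-commute f n x)

iter-injective : ∀ {A : Set} (f : A → A) → Injective _≡_ _≡_ f → ∀ n → Injective _≡_ _≡_ (iter f n)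
iter-injective f f-inj zero    eq = eq
iter-injective f f-inj (suc n) eq = iter-injective f f-inj n (f-inj eq)

even-or-odd : ∀ n → ∃ λ d → n ≡ d + d ⊎ n ≡ suc (d + d)
even-or-odd zero = 0 , inj₁ refl
even-or-odd (suc n) with even-or-odd n
... | d , inj₁ eq = d , inj₂ (cong suc eq)
... | d , inj₂ eq = suc d , inj₁ (cong suc (trans eq (sym (+-suc d d))))

least-witness : ∀ {P : ℕ → Set} → (∀ n → Dec (P n)) → ∀ n → P n →
  ∃ λ m → P m × (∀ k → k < m → ¬ P k)
least-witness {P} P? = <-rec (λ n → P n → ∃ λ m → P m × (∀ k → k < m → ¬ P k)) search
  where
    search : ∀ n → (∀ {k} → k < n → P k → ∃ λ m → P m × (∀ j → j < m → ¬ P j)) →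
      P n → ∃ λ m → P m × (∀ k → k < m → ¬ P k)
    search n below Pn with anyUpTo? P? n
    ... | yes (k , k<n , Pk) = below k<n Pk
    ... | no none = n , Pn , λ k k<n Pk → none (k , k<n , Pk)

m+m<n+n⇒m<n : ∀ {m n} → m + m < n + n → m < n
m+m<n+n⇒m<n {m} {n} lt with m <? n
... | yes m<n = m<n
... | no m≮n = ⊥-elim (<⇒≱ lt (+-mono-≤ (≮⇒≥ m≮n) (≮⇒≥ m≮n)))

suc[m%n]%n≡suc[m]%n : ∀ m n → suc (m % suc n) % suc n ≡ suc m % suc n
suc[m%n]%n≡suc[m]%n m n = begin
  suc (m % suc n) % suc n                 ≡⟨ %-distribˡ-+ 1 (m % suc n) (suc n) ⟩
  (1 % suc n + m % suc n % suc n) % suc n ≡⟨ cong (λ w → (1 % suc n + w) % suc n) (m%n%n≡m%n m (suc n)) ⟩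
  (1 % suc n + m % suc n) % suc n         ≡⟨ %-distribˡ-+ 1 m (suc n) ⟨
  suc m % suc n                           ∎
  where open ≡-Reasoning

-- Reduce i to its residue r, then compare d + r with n.
[d+i]%n≢i%n : ∀ n i d → 0 < d → d < suc n → (d + i) % suc n ≢ i % suc n
[d+i]%n≢i%n n i d 0<d d<N eq = residue-moves (i % suc n) (m%n<n i (suc n)) reduced
  where
    open ≡-Reasoning
    reduced : (d + i % suc n) % suc n ≡ i % suc n
    reduced = trans (sym (trans (%-distribˡ-+ d i (suc n)) (cong (λ w → (w + i % suc n) % suc n) (m<n⇒m%n≡m d<N)))) eq
    residue-moves : ∀ r → r < suc n → (d + r) % suc n ≢ r
    residue-moves r r<N eq′ with d + r <? suc n
    ... | yes small = <⇒≢ 0<d (sym (+-cancelʳ-≡ r d 0 (trans (sym (m<n⇒m%n≡m small)) eq′)))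
    ... | no big = <⇒≢ d<N (+-cancelʳ-≡ r d (suc n) (begin
        d + r                 ≡⟨ m∸n+n≡m N≤d+r ⟨
        d + r ∸ suc n + suc n ≡⟨ cong (_+ suc n) wrapped ⟩
        r + suc n             ≡⟨ +-comm r (suc n) ⟩
        suc n + r             ∎))
      where
        N≤d+r : suc n ≤ d + r
        N≤d+r = ≮⇒≥ big
        wrapped : d + r ∸ suc n ≡ r
        wrapped = trans (sym (m<n⇒m%n≡m (subst (d + r ∸ suc n <_) (m+n∸n≡m (suc n) (suc n))
                    (∸-monoˡ-< (+-mono-< d<N r<N) N≤d+r))))
                  (trans (m≤n⇒[n∸m]%m≡n%m N≤d+r) eq′)

false≢true : false ≢ true
false≢true ()

nothing≢just : ∀ {A : Set} {x : A} → nothing ≢ just x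
nothing≢just ()

other-≢ : ∀ {a b : Fin 2} → a ≢ b → other a ≡ b
other-≢ {zero}     {zero}     a≢b = ⊥-elim (a≢b refl)
other-≢ {zero}     {suc zero} _   = refl
other-≢ {suc zero} {zero}     _   = refl
other-≢ {suc zero} {suc zero} a≢b = ⊥-elim (a≢b refl)

Fin2-pigeonhole : ∀ (j j₁ j₂ : Fin 2) → j ≡ j₁ ⊎ j ≡ j₂ ⊎ j₁ ≡ j₂
Fin2-pigeonhole zero       zero       _          = inj₁ refl
Fin2-pigeonhole (suc zero) (suc zero) _          = inj₁ refl
Fin2-pigeonhole zero       (suc zero) zero       = inj₂ (inj₁ refl)
Fin2-pigeonhole zero       (suc zero) (suc zero) = inj₂ (inj₂ refl)
Fin2-pigeonhole (suc zero) zero       (suc zero) = inj₂ (inj₁ refl)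
Fin2-pigeonhole (suc zero) zero       zero       = inj₂ (inj₂ refl)

count-cong : ∀ {m} (P Q : Fin m → Bool) → (∀ i → P i ≡ Q i) → count P ≡ count Q
count-cong {zero}  P Q P≡Q = refl
count-cong {suc m} P Q P≡Q =
  cong₂ _+_ (cong (λ b → if b then 1 else 0) (P≡Q zero)) (count-cong (λ i → P (suc i)) (λ i → Q (suc i)) (λ i → P≡Q (suc i)))

count-mono : ∀ {m} (P Q : Fin m → Bool) → (∀ i → P i ≡ true → Q i ≡ true) → count P ≤ count Q
count-mono {zero}  P Q P⊆Q = z≤n
count-mono {suc m} P Q P⊆Q with P zero in P0 | Q zero in Q0
... | true  | true  = s≤s (count-mono _ _ (λ i → P⊆Q (suc i)))
... | false | true  = m≤n⇒m≤1+n (count-mono _ _ (λ i → P⊆Q (suc i)))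
... | false | false = count-mono _ _ (λ i → P⊆Q (suc i))
... | true  | false = ⊥-elim (false≢true (trans (sym Q0) (P⊆Q zero P0)))

count-saturated : ∀ {m} (P Q : Fin m → Bool) → (∀ i → P i ≡ true → Q i ≡ true) →
  count Q ≤ count P → ∀ i → Q i ≡ true → P i ≡ true
count-saturated {suc m} P Q P⊆Q Q≤P i Qi with P zero in P0 | Q zero in Q0 | i
... | true  | false | _ = ⊥-elim (false≢true (trans (sym Q0) (P⊆Q zero P0)))
... | false | true  | _ =
  ⊥-elim (<-irrefl refl (≤-trans Q≤P (count-mono (λ i → P (suc i)) (λ i → Q (suc i)) (λ i → P⊆Q (suc i)))))
... | true  | true  | zero   = P0
... | false | false | zero   = ⊥-elim (false≢true (trans (sym Q0) Qi))
... | true  | true  | suc i′ = count-saturated _ _ (λ i → P⊆Q (suc i)) (≤-pred Q≤P) i′ Qi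
... | false | false | suc i′ = count-saturated _ _ (λ i → P⊆Q (suc i)) Q≤P i′ Qi

count-one-more : ∀ {m} (P Q : Fin m → Bool) (e : Fin m) → P e ≡ false → Q e ≡ true →
  (∀ i → i ≢ e → P i ≡ Q i) → count Q ≡ suc (count P)
count-one-more P Q zero Pe Qe P≡Q rewrite Pe | Qe =
  cong suc (sym (count-cong (λ i → P (suc i)) (λ i → Q (suc i)) (λ i → P≡Q (suc i) (λ ()))))
count-one-more P Q (suc e) Pe Qe P≡Q rewrite P≡Q zero (λ ()) =
  trans (cong ((if Q zero then 1 else 0) +_)
          (count-one-more (λ i → P (suc i)) (λ i → Q (suc i)) e Pe Qe (λ i i≢e → P≡Q (suc i) (λ eq → i≢e (FP.suc-injective eq)))))
        (+-suc _ _)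

eqB-refl : ∀ b → eqB b b ≡ true
eqB-refl inX = refl
eqB-refl inY = refl
eqB-refl inZ = refl

eqB⇒≡ : ∀ b b′ → eqB b b′ ≡ true → b ≡ b′
eqB⇒≡ inX inX _ = refl
eqB⇒≡ inY inY _ = refl
eqB⇒≡ inZ inZ _ = refl
eqB⇒≡ inX inY ()
eqB⇒≡ inX inZ ()
eqB⇒≡ inY inX ()
eqB⇒≡ inY inZ ()
eqB⇒≡ inZ inX ()
eqB⇒≡ inZ inY ()

≢⇒eqB≡false : ∀ b b′ → b ≢ b′ → eqB b b′ ≡ false
≢⇒eqB≡false b b′ b≢b′ with eqB b b′ in eq
... | true  = ⊥-elim (b≢b′ (eqB⇒≡ b b′ eq))
... | false = refl

_≟B_ : Decidable {A = Block} _≡_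
b ≟B b′ with eqB b b′ in eq
... | true  = yes (eqB⇒≡ b b′ eq)
... | false = no λ { refl → false≢true (trans (sym eq) (eqB-refl b)) }

anotherBlock : Block → Block
anotherBlock inX = inY
anotherBlock inY = inX
anotherBlock inZ = inX

anotherBlock-≢ : ∀ b → anotherBlock b ≢ b
anotherBlock-≢ inX ()
anotherBlock-≢ inY ()
anotherBlock-≢ inZ ()

blocks-exhausted : ∀ {a b c d : Block} → a ≢ b → b ≢ c → c ≢ a → d ≢ a → d ≢ b → d ≡ c
blocks-exhausted {a} {b} {c} {d} a≢b b≢c c≢a d≢a d≢b =
  go a b c d (≢⇒eqB≡false a b a≢b) (≢⇒eqB≡false b c b≢c) (≢⇒eqB≡false c a c≢a)
             (≢⇒eqB≡false d a d≢a) (≢⇒eqB≡false d b d≢b)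
  where
    go : ∀ a b c d → eqB a b ≡ false → eqB b c ≡ false → eqB c a ≡ false →
         eqB d a ≡ false → eqB d b ≡ false → d ≡ c
    go inX inX _ _ () _ _ _ _
    go inY inY _ _ () _ _ _ _
    go inZ inZ _ _ () _ _ _ _
    go _ inX inX _ _ () _ _ _
    go _ inY inY _ _ () _ _ _
    go _ inZ inZ _ _ () _ _ _
    go inX _ inX _ _ _ () _ _
    go inY _ inY _ _ _ () _ _
    go inZ _ inZ _ _ _ () _ _
    go inX _ _ inX _ _ _ () _
    go inY _ _ inY _ _ _ () _
    go inZ _ _ inZ _ _ _ () _
    go _ inX _ inX _ _ _ _ ()
    go _ inY _ inY _ _ _ _ ()
    go _ inZ _ inZ _ _ _ _ ()
    go _ _ inX inX _ _ _ _ _ = refl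
    go _ _ inY inY _ _ _ _ _ = refl
    go _ _ inZ inZ _ _ _ _ _ = refl

module _ {m : ℕ} (IsBasis : (Fin m → Block) → Set) where
  open MM IsBasis

  ⊆basis⇒independent : ∀ B S → IsBasis B → (∀ f b → S f ≡ just b → B f ≡ b) → ¬ Dependent S
  ⊆basis⇒independent B S B-basis S⊆B (r , (_ , rank-bound) , r<size) =
    <-irrefl refl (≤-<-trans (≤-reflexive (sym meet≡size)) (≤-<-trans (rank-bound B B-basis) r<size))
    where
      pointwise : ∀ f → memB (S f) (B f) ≡ isJust (S f)
      pointwise f with S f in Sf
      ... | nothing = refl
      ... | just b  = trans (cong (eqB b) (S⊆B f b Sf)) (eqB-refl b)
      meet≡size : meet B S ≡ size S
      meet≡size = count-cong _ _ pointwise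

-- Boundary curves

-- A boundary curve alternates between edge arcs and vertex arcs.  From a corner x,
-- across p x is the other end of the edge arc at x (an edge side, or an attachment
-- segment when the edge is deleted), and around x the other end of the vertex arc.
module Boundary (G : RibbonGraph) where
  E : ℕ
  E = nE G

  Cnr : Set
  Cnr = Corner E

  edgeOf : Cnr → Fin E
  edgeOf ((e , _) , _) = e

  acrossSide : Bool → Cnr → Cnr
  acrossSide true  ((e , j) , k) = ((e , other j) , k)
  acrossSide false ((e , j) , k) = ((e , other j) , other k)

  sideOf : Bool → Cnr → Fin 2
  sideOf true  ((e , j) , k)        = k
  sideOf false ((e , zero) , k)     = k
  sideOf false ((e , suc zero) , k) = other k

  acrossSegment : Cnr → Cnr
  acrossSegment ((e , j) , k) = ((e , j) , other k)

  acrossBlock : Bool → Block → Cnr → Cnr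
  acrossBlock tw inY c = acrossSegment c
  acrossBlock tw inX c = acrossSide (tw xor isZ inX) c
  acrossBlock tw inZ c = acrossSide (tw xor isZ inZ) c

  Arc₀ : Set
  Arc₀ = End E ⊎ (Fin E × Fin 2)

  edgeArcBlock : Bool → Block → Cnr → Arc₀
  edgeArcBlock tw inY ((e , j) , k) = inj₂ (e , j)
  edgeArcBlock tw inX c = inj₂ (edgeOf c , sideOf (tw xor isZ inX) c)
  edgeArcBlock tw inZ c = inj₂ (edgeOf c , sideOf (tw xor isZ inZ) c)

  across : Partition G → Cnr → Cnr
  across p c = acrossBlock (twist G (edgeOf c)) (p (edgeOf c)) c

  edgeArc : Partition G → Cnr → Arc₀
  edgeArc p c = edgeArcBlock (twist G (edgeOf c)) (p (edgeOf c)) c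

  around : Cnr → Cnr
  around (h , zero)     = (pred G h , suc zero)
  around (h , suc zero) = (succ G h , zero)

  vertexArc : Cnr → Arc₀
  vertexArc (h , zero)     = inj₁ (pred G h)
  vertexArc (h , suc zero) = inj₁ h

  acrossSide-involutive : ∀ s c → acrossSide s (acrossSide s c) ≡ c
  acrossSide-involutive true  ((e , zero) , k)            = refl
  acrossSide-involutive true  ((e , suc zero) , k)        = refl
  acrossSide-involutive false ((e , zero) , zero)         = refl
  acrossSide-involutive false ((e , zero) , suc zero)     = refl
  acrossSide-involutive false ((e , suc zero) , zero)     = refl
  acrossSide-involutive false ((e , suc zero) , suc zero) = refl

  sideOf-acrossSide : ∀ s c → sideOf s (acrossSide s c) ≡ sideOf s c
  sideOf-acrossSide true  ((e , zero) , k)            = refl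
  sideOf-acrossSide true  ((e , suc zero) , k)        = refl
  sideOf-acrossSide false ((e , zero) , zero)         = refl
  sideOf-acrossSide false ((e , zero) , suc zero)     = refl
  sideOf-acrossSide false ((e , suc zero) , zero)     = refl
  sideOf-acrossSide false ((e , suc zero) , suc zero) = refl

  acrossSegment-involutive : ∀ c → acrossSegment (acrossSegment c) ≡ c
  acrossSegment-involutive ((e , j) , zero)     = refl
  acrossSegment-involutive ((e , j) , suc zero) = refl

  acrossBlock-involutive : ∀ tw b c → acrossBlock tw b (acrossBlock tw b c) ≡ c
  acrossBlock-involutive tw inY c = acrossSegment-involutive c
  acrossBlock-involutive tw inX c = acrossSide-involutive (tw xor isZ inX) c
  acrossBlock-involutive tw inZ c = acrossSide-involutive (tw xor isZ inZ) c

  acrossBlock-injective : ∀ tw b → Injective _≡_ _≡_ (acrossBlock tw b)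
  acrossBlock-injective tw b {u} {v} eq =
    trans (sym (acrossBlock-involutive tw b u)) (trans (cong (acrossBlock tw b) eq) (acrossBlock-involutive tw b v))

  edgeOf-acrossBlock : ∀ tw b c → edgeOf (acrossBlock tw b c) ≡ edgeOf c
  edgeOf-acrossBlock tw inY ((e , j) , k) = refl
  edgeOf-acrossBlock tw inX ((e , j) , k) with tw xor isZ inX
  ... | true  = refl
  ... | false = refl
  edgeOf-acrossBlock tw inZ ((e , j) , k) with tw xor isZ inZ
  ... | true  = refl
  ... | false = refl

  edgeArcBlock-acrossBlock : ∀ tw b c → edgeArcBlock tw b (acrossBlock tw b c) ≡ edgeArcBlock tw b c
  edgeArcBlock-acrossBlock tw inY ((e , j) , k) = refl
  edgeArcBlock-acrossBlock tw inX c =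
    cong₂ (λ u v → inj₂ (u , v)) (edgeOf-acrossBlock tw inX c) (sideOf-acrossSide (tw xor isZ inX) c)
  edgeArcBlock-acrossBlock tw inZ c =
    cong₂ (λ u v → inj₂ (u , v)) (edgeOf-acrossBlock tw inZ c) (sideOf-acrossSide (tw xor isZ inZ) c)

  across-on : ∀ p x e → edgeOf x ≡ e → across p x ≡ acrossBlock (twist G e) (p e) x
  across-on p ((e , j) , k) .e refl = refl

  edgeArc-on : ∀ p x e → edgeOf x ≡ e → edgeArc p x ≡ edgeArcBlock (twist G e) (p e) x
  edgeArc-on p ((e , j) , k) .e refl = refl

  edgeOf-across : ∀ p x → edgeOf (across p x) ≡ edgeOf x
  edgeOf-across p x = edgeOf-acrossBlock (twist G (edgeOf x)) (p (edgeOf x)) x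

  across-involutive : ∀ p x → across p (across p x) ≡ x
  across-involutive p x = trans (across-on p (across p x) (edgeOf x) (edgeOf-across p x))
                                (acrossBlock-involutive (twist G (edgeOf x)) (p (edgeOf x)) x)

  edgeArc-across : ∀ p x → edgeArc p (across p x) ≡ edgeArc p x
  edgeArc-across p x = trans (edgeArc-on p (across p x) (edgeOf x) (edgeOf-across p x))
                             (edgeArcBlock-acrossBlock (twist G (edgeOf x)) (p (edgeOf x)) x)

  across-agrees : ∀ p q x → q (edgeOf x) ≡ p (edgeOf x) → across q x ≡ across p x
  across-agrees p q x eq = cong (λ b → acrossBlock (twist G (edgeOf x)) b x) eq

  around-involutive : ∀ x → around (around x) ≡ x
  around-involutive (h , zero)     = cong (_, zero) (succ-pred G h)
  around-involutive (h , suc zero) = cong (_, suc zero) (pred-succ G h)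

  acrossSide-moves : ∀ s x → acrossSide s x ≢ x
  acrossSide-moves true  ((e , zero) , k)     ()
  acrossSide-moves true  ((e , suc zero) , k) ()
  acrossSide-moves false ((e , zero) , k)     ()
  acrossSide-moves false ((e , suc zero) , k) ()

  acrossSegment-moves : ∀ x → acrossSegment x ≢ x
  acrossSegment-moves ((e , j) , zero)     ()
  acrossSegment-moves ((e , j) , suc zero) ()

  acrossBlock-moves : ∀ tw b x → acrossBlock tw b x ≢ x
  acrossBlock-moves tw inY x = acrossSegment-moves x
  acrossBlock-moves tw inX x = acrossSide-moves _ x
  acrossBlock-moves tw inZ x = acrossSide-moves _ x

  across-moves : ∀ p x → across p x ≢ x
  across-moves p x = acrossBlock-moves (twist G (edgeOf x)) (p (edgeOf x)) x

  around-moves : ∀ x → around x ≢ x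
  around-moves (h , zero)     ()
  around-moves (h , suc zero) ()

  edgeArc-shape : ∀ p x → ∃ λ j → edgeArc p x ≡ inj₂ (edgeOf x , j)
  edgeArc-shape p x = shape (twist G (edgeOf x)) (p (edgeOf x)) x
    where
      shape : ∀ tw b x → ∃ λ j → edgeArcBlock tw b x ≡ inj₂ (edgeOf x , j)
      shape tw inY ((e , j) , k) = j , refl
      shape tw inX x = _ , refl
      shape tw inZ x = _ , refl

  vertexArc-shape : ∀ x → ∃ λ h → vertexArc x ≡ inj₁ h
  vertexArc-shape (h , zero)     = _ , refl
  vertexArc-shape (h , suc zero) = _ , refl

  edgeArc≢vertexArc : ∀ p x y → edgeArc p x ≢ vertexArc y
  edgeArc≢vertexArc p x y eq with trans (sym (proj₂ (edgeArc-shape p x))) (trans eq (proj₂ (vertexArc-shape y)))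
  ... | ()

  label-edgeArc : ∀ p x → label G p (edgeArc p x) ≡ just (edgeOf x)
  label-edgeArc p x rewrite proj₂ (edgeArc-shape p x) = refl

  label-vertexArc : ∀ p x → label G p (vertexArc x) ≡ nothing
  label-vertexArc p x rewrite proj₂ (vertexArc-shape x) = refl

  sideEnds-shape : ∀ p s e j x y → sideEnds G p s e j ≡ (x , y) →
    edgeOf x ≡ e × j ≡ sideOf s x × y ≡ acrossSide s x
  sideEnds-shape p true  e zero       _ _ refl = refl , refl , refl
  sideEnds-shape p true  e (suc zero) _ _ refl = refl , refl , refl
  sideEnds-shape p false e zero       _ _ refl = refl , refl , refl
  sideEnds-shape p false e (suc zero) _ _ refl = refl , refl , refl

  edgeArcEnds-shape : ∀ p b e j x y → edgeArcEnds G p b e j ≡ (x , y) →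
    edgeOf x ≡ e × inj₂ (e , j) ≡ edgeArcBlock (twist G e) b x × y ≡ acrossBlock (twist G e) b x
  edgeArcEnds-shape p inY e j _ _ refl = refl , refl , refl
  edgeArcEnds-shape p inX e j x y eq with sideEnds-shape p (twist G e xor isZ inX) e j x y eq
  ... | refl , j≡ , y≡ = refl , cong (λ i → inj₂ (e , i)) j≡ , y≡
  edgeArcEnds-shape p inZ e j x y eq with sideEnds-shape p (twist G e xor isZ inZ) e j x y eq
  ... | refl , j≡ , y≡ = refl , cong (λ i → inj₂ (e , i)) j≡ , y≡

  joins-sym : ∀ {p a x y} → Joins G p a x y → Joins G p a y x
  joins-sym (inj₁ eq) = inj₂ eq
  joins-sym (inj₂ eq) = inj₁ eq

  joins-edge : ∀ p e j x y → Joins G p (inj₂ (e , j)) x y → inj₂ (e , j) ≡ edgeArc p x × y ≡ across p x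
  joins-edge p e j x y (inj₁ eq) with edgeArcEnds-shape p (p e) e j x y eq
  ... | x-on-e , a≡ , y≡ = trans a≡ (sym (edgeArc-on p x e x-on-e)) , trans y≡ (sym (across-on p x e x-on-e))
  joins-edge p e j x y (inj₂ eq) with edgeArcEnds-shape p (p e) e j y x eq
  ... | refl , a≡ , x≡ = trans a≡ (trans (sym (trans (cong (edgeArcBlock tw b) x≡) (edgeArcBlock-acrossBlock tw b y)))
                                         (sym (edgeArc-on p x e x-on-e)))
                       , trans (sym (acrossBlock-involutive tw b y)) (trans (cong (acrossBlock tw b) (sym x≡))
                                                                             (sym (across-on p x e x-on-e)))
    where
      tw : Bool
      tw = twist G e
      b : Block
      b = p e
      x-on-e : edgeOf x ≡ e
      x-on-e = trans (cong edgeOf x≡) (edgeOf-acrossBlock tw b y)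

  joins-vertex : ∀ p h x y → Joins G p (inj₁ h) x y → inj₁ h ≡ vertexArc x × y ≡ around x
  joins-vertex p h _ _ (inj₁ refl) = refl , refl
  joins-vertex p h _ _ (inj₂ refl) = cong inj₁ (sym (pred-succ G h)) , cong (_, suc zero) (sym (pred-succ G h))

  joins-cases : ∀ p a x y → Joins G p a x y →
    (a ≡ edgeArc p x × y ≡ across p x) ⊎ (a ≡ vertexArc x × y ≡ around x)
  joins-cases p (inj₁ h)       x y J = inj₂ (joins-vertex p h x y J)
  joins-cases p (inj₂ (e , j)) x y J = inj₁ (joins-edge p e j x y J)

  edgeArc-joins : ∀ p x → Joins G p (edgeArc p x) x (across p x)
  edgeArc-joins p x = by-block x (p (edgeOf x)) refl
    where
      side-joins : ∀ s x → (sideEnds G p s (edgeOf x) (sideOf s x) ≡ (x , acrossSide s x)) ⊎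
                           (sideEnds G p s (edgeOf x) (sideOf s x) ≡ (acrossSide s x , x))
      side-joins true  ((e , zero) , k)            = inj₁ refl
      side-joins true  ((e , suc zero) , k)        = inj₂ refl
      side-joins false ((e , zero) , zero)         = inj₁ refl
      side-joins false ((e , zero) , suc zero)     = inj₁ refl
      side-joins false ((e , suc zero) , zero)     = inj₂ refl
      side-joins false ((e , suc zero) , suc zero) = inj₂ refl
      by-block : ∀ x b → p (edgeOf x) ≡ b →
        Joins G p (edgeArcBlock (twist G (edgeOf x)) b x) x (acrossBlock (twist G (edgeOf x)) b x)
      by-block ((e , j) , zero)     inY eq rewrite eq = inj₁ refl
      by-block ((e , j) , suc zero) inY eq rewrite eq = inj₂ refl
      by-block x inX eq rewrite eq = side-joins (twist G (edgeOf x) xor isZ inX) x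
      by-block x inZ eq rewrite eq = side-joins (twist G (edgeOf x) xor isZ inZ) x

  vertexArc-joins : ∀ p x → Joins G p (vertexArc x) x (around x)
  vertexArc-joins p (h , zero)     = inj₂ (cong (λ u → ((pred G h , suc zero) , (u , zero))) (succ-pred G h))
  vertexArc-joins p (h , suc zero) = inj₁ refl

  joins-irreflexive : ∀ p a x → ¬ Joins G p a x x
  joins-irreflexive p a x J with joins-cases p a x x J
  ... | inj₁ (_ , x≡) = across-moves p x (sym x≡)
  ... | inj₂ (_ , x≡) = around-moves x (sym x≡)

  joins-functional : ∀ p a x y y′ → Joins G p a x y → Joins G p a x y′ → y ≡ y′
  joins-functional p a x y y′ J J′ with joins-cases p a x y J | joins-cases p a x y′ J′
  ... | inj₁ (_ , y≡) | inj₁ (_ , y′≡) = trans y≡ (sym y′≡)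
  ... | inj₁ (a≡ , _) | inj₂ (a≡′ , _) = ⊥-elim (edgeArc≢vertexArc p x x (trans (sym a≡) a≡′))
  ... | inj₂ (a≡ , _) | inj₁ (a≡′ , _) = ⊥-elim (edgeArc≢vertexArc p x x (trans (sym a≡′) a≡))
  ... | inj₂ (_ , y≡) | inj₂ (_ , y′≡) = trans y≡ (sym y′≡)

  joins-endpoint : ∀ p a x y u v → Joins G p a x y → Joins G p a u v → x ≡ u ⊎ x ≡ v
  joins-endpoint p a x y u v (inj₁ e₁) (inj₁ e₂) = inj₁ (cong proj₁ (trans (sym e₁) e₂))
  joins-endpoint p a x y u v (inj₁ e₁) (inj₂ e₂) = inj₂ (cong proj₁ (trans (sym e₁) e₂))
  joins-endpoint p a x y u v (inj₂ e₁) (inj₁ e₂) = inj₂ (cong proj₂ (trans (sym e₁) e₂))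
  joins-endpoint p a x y u v (inj₂ e₁) (inj₂ e₂) = inj₁ (cong proj₂ (trans (sym e₁) e₂))

  labelled-joins : ∀ p a x y g → Joins G p a x y → label G p a ≡ just g →
    a ≡ edgeArc p x × y ≡ across p x × edgeOf x ≡ g
  labelled-joins p a x y g J lab with joins-cases p a x y J
  ... | inj₁ (a≡ , y≡) =
    a≡ , y≡ , just-injective (trans (sym (label-edgeArc p x)) (trans (cong (label G p) (sym a≡)) lab))
  ... | inj₂ (a≡ , y≡) with trans (sym (label-vertexArc p x)) (trans (cong (label G p) (sym a≡)) lab)
  ...   | ()

  edgeArc-injective : ∀ p u v → edgeArc p u ≡ edgeArc p v → v ≡ u ⊎ v ≡ across p u
  edgeArc-injective p u v eq = joins-endpoint p (edgeArc p u) v (across p v) u (across p u)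
    (subst (λ a → Joins G p a v (across p v)) (sym eq) (edgeArc-joins p v)) (edgeArc-joins p u)

  vertexArc-injective : ∀ p u v → vertexArc u ≡ vertexArc v → v ≡ u ⊎ v ≡ around u
  vertexArc-injective p u v eq = joins-endpoint p (vertexArc u) v (around v) u (around u)
    (subst (λ a → Joins G p a v (around v)) (sym eq) (vertexArc-joins p v)) (vertexArc-joins p u)

  Linked : Partition G → Cnr → Cnr → Set
  Linked p x y = EqClosure (BAdj G p) (inj₁ x) (inj₁ y)

  joins⇒linked : ∀ p a x y → Joins G p a x y → Linked p x y
  joins⇒linked p a x y (inj₁ eq) = fwd (a , eq) ◅ ε
  joins⇒linked p a x y (inj₂ eq) = bwd (a , eq) ◅ ε

  linked-across : ∀ p x → Linked p x (across p x)
  linked-across p x = joins⇒linked p (edgeArc p x) x (across p x) (edgeArc-joins p x)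

  linked-around : ∀ p x → Linked p x (around x)
  linked-around p x = joins⇒linked p (vertexArc x) x (around x) (vertexArc-joins p x)

  linked-sym : ∀ {p x y} → Linked p x y → Linked p y x
  linked-sym {p} = EqC.symmetric (BAdj G p)

  linked-trans : ∀ {p x y z} → Linked p x y → Linked p y z → Linked p x z
  linked-trans = _◅◅_

  linked-transport : ∀ p (Q : Cnr → Set) → (∀ x → Q x → Q (across p x)) → (∀ x → Q x → Q (around x)) →
    ∀ {x y} → Linked p x y → Q x → Q y
  linked-transport p Q Q-across Q-around = go
    where
      Q′ : BPoint G p → Set
      Q′ (inj₁ x) = Q x
      Q′ (inj₂ _) = ⊥
      step : ∀ a x y → Joins G p a x y → Q x → Q y
      step a x y J Qx with joins-cases p a x y J
      ... | inj₁ (_ , refl) = Q-across x Qx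
      ... | inj₂ (_ , refl) = Q-around x Qx
      go : ∀ {u v} → EqClosure (BAdj G p) u v → Q′ u → Q′ v
      go ε Qu = Qu
      go {inj₁ x} (_◅_ {j = inj₁ y} (fwd (a , eq)) rest) Qx = go rest (step a x y (inj₁ eq) Qx)
      go {inj₁ x} (_◅_ {j = inj₁ y} (bwd (a , eq)) rest) Qx = go rest (step a x y (inj₂ eq) Qx)
      go {inj₁ x} (_◅_ {j = inj₂ _} (fwd ()) rest) Qx
      go {inj₁ x} (_◅_ {j = inj₂ _} (bwd ()) rest) Qx
      go {inj₂ _} (_ ◅ rest) ()

  SameComponent : Fin (nV G) → Fin (nV G) → Set
  SameComponent = EqClosure (GAdj G)

  vertexOfCorner : Cnr → Fin (nV G)
  vertexOfCorner (h , k) = vertexOf G h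

  vertexOfPoint : ∀ p → BPoint G p → Fin (nV G)
  vertexOfPoint p (inj₁ c)       = vertexOfCorner c
  vertexOfPoint p (inj₂ (v , _)) = v

  sameEdge⇒sameComponent : ∀ x y → edgeOf x ≡ edgeOf y → SameComponent (vertexOfCorner x) (vertexOfCorner y)
  sameEdge⇒sameComponent ((e , zero) , k)     ((.e , zero) , k′)     refl = ε
  sameEdge⇒sameComponent ((e , zero) , k)     ((.e , suc zero) , k′) refl = fwd (e , refl , refl) ◅ ε
  sameEdge⇒sameComponent ((e , suc zero) , k) ((.e , zero) , k′)     refl = bwd (e , refl , refl) ◅ ε
  sameEdge⇒sameComponent ((e , suc zero) , k) ((.e , suc zero) , k′) refl = ε

  vertexOfCorner-around : ∀ x → vertexOfCorner (around x) ≡ vertexOfCorner x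
  vertexOfCorner-around (h , zero)     = trans (sym (succ-vertex G (pred G h))) (cong (vertexOf G) (succ-pred G h))
  vertexOfCorner-around (h , suc zero) = succ-vertex G h

  adjacent⇒sameComponent : ∀ p {u v} → BAdj G p u v → SameComponent (vertexOfPoint p u) (vertexOfPoint p v)
  adjacent⇒sameComponent p {inj₁ x} {inj₁ y} (a , eq) with joins-cases p a x y (inj₁ eq)
  ... | inj₁ (_ , refl) = sameEdge⇒sameComponent x (across p x) (sym (edgeOf-across p x))
  ... | inj₂ (_ , refl) rewrite vertexOfCorner-around x = ε

  connected⇒sameComponent : ∀ p {u v} → EqClosure (BAdj G p) u v →
    SameComponent (vertexOfPoint p u) (vertexOfPoint p v)
  connected⇒sameComponent p = EqC.gfold (EqC.isEquivalence (GAdj G)) (vertexOfPoint p) (adjacent⇒sameComponent p)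

  linked⇒sameComponent : ∀ p {x y} → Linked p x y → SameComponent (vertexOfCorner x) (vertexOfCorner y)
  linked⇒sameComponent p = connected⇒sameComponent p

  -- Every boundary curve lies in one component and every component carries one, so
  -- sending the class of a curve to the class of its component is a surjection between
  -- two copies of Fin n, hence injective: a component carries exactly one curve.
  basis⇒linked : ∀ p → InQ G p → ∀ x y → SameComponent (vertexOfCorner x) (vertexOfCorner y) → Linked p x y
  basis⇒linked p (n , (curve , curve-onto , curve-classes) , (comp , comp-onto , comp-classes)) x y xy =
    Equivalence.to (curve-classes (inj₁ x) (inj₁ y))
      (endo-surjective⇒injective φ φ-onto
        (trans (φ-curve (inj₁ x)) (trans (Equivalence.from (comp-classes _ _) xy) (sym (φ-curve (inj₁ y))))))
    where
      φ : Fin n → Fin n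
      φ i = comp (vertexOfPoint p (proj₁ (curve-onto i)))
      φ-curve : ∀ u → φ (curve u) ≡ comp (vertexOfPoint p u)
      φ-curve u = Equivalence.from (comp-classes _ _)
        (connected⇒sameComponent p (Equivalence.to (curve-classes _ _) (proj₂ (curve-onto (curve u)))))
      φ-onto : ∀ i → ∃ λ j → φ j ≡ i
      φ-onto i with comp-onto i
      ... | v , v↦i with any? (λ e → any? (λ j → vertexOf G (e , j) FP.≟ v))
      ...   | yes (e , j , at-v) = curve (inj₁ ((e , j) , zero)) , trans (φ-curve _) (trans (cong comp at-v) v↦i)
      ...   | no isolated =
        curve (inj₂ (v , λ h at-v → isolated (proj₁ h , proj₂ h , at-v))) , trans (φ-curve _) v↦i

  -- The curve classes of q then coincide with those of p, so the counting witness for p serves q.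
  linked⇒basis : ∀ p q → InQ G p →
    (∀ x y → SameComponent (vertexOfCorner x) (vertexOfCorner y) → Linked q x y) → InQ G q
  linked⇒basis p q p-basis@(n , (curve , curve-onto , curve-classes) , comps) q-links =
    n , (curve , curve-onto , classes) , comps
    where
      q⇒p : ∀ {u v} → BAdj G q u v → EqClosure (BAdj G p) u v
      q⇒p {inj₁ x} {inj₁ y} adj = basis⇒linked p p-basis x y (adjacent⇒sameComponent q {inj₁ x} {inj₁ y} adj)
      p⇒q : ∀ {u v} → BAdj G p u v → EqClosure (BAdj G q) u v
      p⇒q {inj₁ x} {inj₁ y} adj = q-links x y (adjacent⇒sameComponent p {inj₁ x} {inj₁ y} adj)
      classes : ∀ u v → (curve u ≡ curve v) ⇔ EqClosure (BAdj G q) u v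
      classes u v = mk⇔
        (λ eq → EqC.fold (EqC.isEquivalence (BAdj G q)) p⇒q (Equivalence.to (curve-classes u v) eq))
        (λ lk → Equivalence.from (curve-classes u v) (EqC.fold (EqC.isEquivalence (BAdj G p)) q⇒p lk))

  sameEdge-cases : ∀ u v → edgeOf u ≡ edgeOf v → u ≢ v → v ≡ acrossSegment u ⊎ ∃ λ s → v ≡ acrossSide s u
  sameEdge-cases ((e , j) , k) ((.e , j′) , k′) refl u≢v with j FP.≟ j′ | k FP.≟ k′
  ... | yes refl | yes refl = ⊥-elim (u≢v refl)
  ... | yes refl | no k≢k′  = inj₁ (cong ((e , j) ,_) (sym (other-≢ k≢k′)))
  ... | no j≢j′  | yes refl = inj₂ (true , cong (λ i → ((e , i) , k)) (sym (other-≢ j≢j′)))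
  ... | no j≢j′  | no k≢k′  =
    inj₂ (false , cong₂ (λ i l → ((e , i) , l)) (sym (other-≢ j≢j′)) (sym (other-≢ k≢k′)))

  acrossSide-comm : ∀ s s′ u → acrossSide s (acrossSide s′ u) ≡ acrossSide s′ (acrossSide s u)
  acrossSide-comm true  true  ((e , j) , k) = refl
  acrossSide-comm true  false ((e , j) , k) = refl
  acrossSide-comm false true  ((e , j) , k) = refl
  acrossSide-comm false false ((e , j) , k) = refl

  acrossSegment-acrossSide-comm : ∀ s u → acrossSegment (acrossSide s u) ≡ acrossSide s (acrossSegment u)
  acrossSegment-acrossSide-comm true  ((e , j) , k) = refl
  acrossSegment-acrossSide-comm false ((e , j) , k) = refl

  acrossSegment≢acrossSide : ∀ s u → acrossSegment u ≢ acrossSide s u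
  acrossSegment≢acrossSide true  ((e , zero) , k)     ()
  acrossSegment≢acrossSide true  ((e , suc zero) , k) ()
  acrossSegment≢acrossSide false ((e , zero) , k)     ()
  acrossSegment≢acrossSide false ((e , suc zero) , k) ()

  acrossSide-≢ : ∀ s s′ u → s ≢ s′ → acrossSide s u ≢ acrossSide s′ u
  acrossSide-≢ true  true  u s≢s′ = ⊥-elim (s≢s′ refl)
  acrossSide-≢ false false u s≢s′ = ⊥-elim (s≢s′ refl)
  acrossSide-≢ true  false ((e , j) , zero)     _ ()
  acrossSide-≢ true  false ((e , j) , suc zero) _ ()
  acrossSide-≢ false true  ((e , j) , zero)     _ ()
  acrossSide-≢ false true  ((e , j) , suc zero) _ ()

  xor-isZ-≢ : ∀ tw → tw xor isZ inX ≢ tw xor isZ inZ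
  xor-isZ-≢ true  ()
  xor-isZ-≢ false ()

  acrossBlock-≢ : ∀ tw b b′ u → b ≢ b′ → acrossBlock tw b u ≢ acrossBlock tw b′ u
  acrossBlock-≢ tw inY inY u b≢b′ = ⊥-elim (b≢b′ refl)
  acrossBlock-≢ tw inX inX u b≢b′ = ⊥-elim (b≢b′ refl)
  acrossBlock-≢ tw inZ inZ u b≢b′ = ⊥-elim (b≢b′ refl)
  acrossBlock-≢ tw inY inX u _ = acrossSegment≢acrossSide _ u
  acrossBlock-≢ tw inY inZ u _ = acrossSegment≢acrossSide _ u
  acrossBlock-≢ tw inX inY u _ = λ eq → acrossSegment≢acrossSide _ u (sym eq)
  acrossBlock-≢ tw inZ inY u _ = λ eq → acrossSegment≢acrossSide _ u (sym eq)
  acrossBlock-≢ tw inX inZ u _ = acrossSide-≢ _ _ u (xor-isZ-≢ tw)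
  acrossBlock-≢ tw inZ inX u _ = acrossSide-≢ _ _ u (λ eq → xor-isZ-≢ tw (sym eq))

  acrossBlock-kind : ∀ tw b → (∀ u → acrossBlock tw b u ≡ acrossSegment u) ⊎
                              (∃ λ s → ∀ u → acrossBlock tw b u ≡ acrossSide s u)
  acrossBlock-kind tw inY = inj₁ (λ u → refl)
  acrossBlock-kind tw inX = inj₂ (_ , λ u → refl)
  acrossBlock-kind tw inZ = inj₂ (_ , λ u → refl)

  acrossBlock-comm : ∀ tw b b′ u → acrossBlock tw b (acrossBlock tw b′ u) ≡ acrossBlock tw b′ (acrossBlock tw b u)
  acrossBlock-comm tw b b′ u with acrossBlock-kind tw b | acrossBlock-kind tw b′
  ... | inj₁ k | inj₁ k′ =
    trans (k _) (trans (cong acrossSegment (k′ u)) (sym (trans (k′ _) (cong acrossSegment (k u)))))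
  ... | inj₁ k | inj₂ (s′ , k′) =
    trans (k _) (trans (cong acrossSegment (k′ u)) (trans (acrossSegment-acrossSide-comm s′ u)
      (sym (trans (k′ _) (cong (acrossSide s′) (k u))))))
  ... | inj₂ (s , k) | inj₁ k′ =
    trans (k _) (trans (cong (acrossSide s) (k′ u)) (trans (sym (acrossSegment-acrossSide-comm s u))
      (sym (trans (k′ _) (cong acrossSegment (k u))))))
  ... | inj₂ (s , k) | inj₂ (s′ , k′) =
    trans (k _) (trans (cong (acrossSide s) (k′ u)) (trans (acrossSide-comm s s′ u)
      (sym (trans (k′ _) (cong (acrossSide s′) (k u))))))

  acrossBlock-onto : ∀ tw u v → edgeOf u ≡ edgeOf v → u ≢ v → ∃ λ b → acrossBlock tw b u ≡ v
  acrossBlock-onto tw u v same u≢v with sameEdge-cases u v same u≢v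
  ... | inj₁ v≡ = inY , sym v≡
  ... | inj₂ (s , v≡) = side-block tw s , trans (side-block-acrosses tw s) (sym v≡)
    where
      side-block : Bool → Bool → Block
      side-block tw s = if tw xor s then inZ else inX
      side-block-acrosses : ∀ tw s → acrossBlock tw (side-block tw s) u ≡ acrossSide s u
      side-block-acrosses true  true  = refl
      side-block-acrosses true  false = refl
      side-block-acrosses false true  = refl
      side-block-acrosses false false = refl

  labelled-arc-shape : ∀ p (a : Arc₀) g → label G p a ≡ just g → ∃ λ j → a ≡ inj₂ (g , j)
  labelled-arc-shape p (inj₂ (g , j)) .g refl = j , refl

  linked-lift : ∀ p q (S : Fin E → Set) → (∀ g → Dec (S g)) → (hub : Cnr) →
    (∀ g → ¬ S g → q g ≡ p g) → (∀ z → S (edgeOf z) → Linked q z hub) →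
    ∀ x y → Linked p x y → Linked q x y
  linked-lift p q S S? hub agree to-hub x y = EqC.fold (EqC.isEquivalence (BAdj G q)) step
    where
      step : ∀ {u v} → BAdj G p u v → EqClosure (BAdj G q) u v
      step {inj₁ x} {inj₁ y} (a , eq) with joins-cases p a x y (inj₁ eq)
      ... | inj₂ (_ , refl) = linked-around q x
      ... | inj₁ (_ , refl) with S? (edgeOf x)
      ...   | yes Sx = linked-trans (to-hub x Sx) (linked-sym (to-hub (across p x) (subst S (sym (edgeOf-across p x)) Sx)))
      ...   | no ¬Sx = subst (Linked q x) (across-agrees p q x (agree _ ¬Sx)) (linked-across q x)

-- Tours along a boundary curve

module Tours (G : RibbonGraph) where
  open Boundary G

  -- A boundary curve unrolled into an N-periodic sequence; arc n joins corner n to corner (n + 1).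
  record Tour (p : Partition G) : Set where
    field
      N               : ℕ
      N≥2             : 2 ≤ N
      arc             : ℕ → Arc₀
      corner          : ℕ → Cnr
      joins           : ∀ n → Joins G p (arc n) (corner n) (corner (suc n))
      arc-periodic    : ∀ n → arc (N + n) ≡ arc n
      corner-periodic : ∀ n → corner (N + n) ≡ corner n
      arc-injective   : ∀ i j → i < j → j < N + i → arc i ≢ arc j

  module TourFacts {p : Partition G} (T : Tour p) where
    open Tour T

    joins-back : ∀ n → Joins G p (arc n) (corner (suc n)) (corner n)
    joins-back n = joins-sym {p} {arc n} (joins n)

    arc-≢ : ∀ u w → u < w → w < N + u → arc w ≢ arc u
    arc-≢ u w u<w w<N+u eq = arc-injective u w u<w w<N+u (sym eq)

    arcs-at : ∀ t a y → Joins G p a (corner (suc t)) y →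
      (a ≡ arc (suc t) × y ≡ corner (suc (suc t))) ⊎ (a ≡ arc t × y ≡ corner t)
    arcs-at t a y J = decide (arc-kind J) (arc-kind (joins (suc t))) (arc-kind (joins-back t))
      where
        z : Cnr
        z = corner (suc t)
        Kind : Arc₀ → Set
        Kind a = a ≡ edgeArc p z ⊎ a ≡ vertexArc z
        arc-kind : ∀ {a y} → Joins G p a z y → Kind a
        arc-kind J = [ (λ c → inj₁ (proj₁ c)) , (λ c → inj₂ (proj₁ c)) ]′ (joins-cases p _ _ _ J)
        forward : a ≡ arc (suc t) → a ≡ arc (suc t) × y ≡ corner (suc (suc t))
        forward refl = refl , joins-functional p a _ y _ J (joins (suc t))
        backward : a ≡ arc t → a ≡ arc t × y ≡ corner t
        backward refl = refl , joins-functional p a _ y _ J (joins-back t)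
        distinct : arc t ≢ arc (suc t)
        distinct = arc-injective t (suc t) (n<1+n t) (+-monoˡ-< t N≥2)
        decide : Kind a → Kind (arc (suc t)) → Kind (arc t) →
          (a ≡ arc (suc t) × y ≡ corner (suc (suc t))) ⊎ (a ≡ arc t × y ≡ corner t)
        decide (inj₁ a≡) (inj₁ a₁≡) _          = inj₁ (forward (trans a≡ (sym a₁≡)))
        decide (inj₂ a≡) (inj₂ a₁≡) _          = inj₁ (forward (trans a≡ (sym a₁≡)))
        decide (inj₁ a≡) (inj₂ _)   (inj₁ a₀≡) = inj₂ (backward (trans a≡ (sym a₀≡)))
        decide (inj₂ a≡) (inj₁ _)   (inj₂ a₀≡) = inj₂ (backward (trans a≡ (sym a₀≡)))
        decide (inj₁ _)  (inj₂ a₁≡) (inj₂ a₀≡) = ⊥-elim (distinct (trans a₀≡ (sym a₁≡)))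
        decide (inj₂ _)  (inj₁ a₁≡) (inj₁ a₀≡) = ⊥-elim (distinct (trans a₀≡ (sym a₁≡)))

    linked-along : ∀ q m n → m ≤ n →
      (∀ i g → m ≤ i → i < n → label G p (arc i) ≡ just g → q g ≡ p g) → Linked q (corner m) (corner n)
    linked-along q m n m≤n agree = go (n ∸ m) m (m+[n∸m]≡n m≤n) agree
      where
        go : ∀ k m → m + k ≡ n → (∀ i g → m ≤ i → i < n → label G p (arc i) ≡ just g → q g ≡ p g) →
          Linked q (corner m) (corner n)
        go zero m m≡n _ rewrite sym m≡n | +-identityʳ m = ε
        go (suc k) m m+k≡n agree =
          linked-trans step (go k (suc m) (trans (sym (+-suc m k)) m+k≡n) (λ i g m<i → agree i g (<⇒≤ m<i)))
          where
            m<n : m < n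
            m<n = subst (m <_) m+k≡n (m<m+n m (s≤s z≤n))
            step : Linked q (corner m) (corner (suc m))
            step with joins-cases p _ _ _ (joins m)
            ... | inj₂ (_ , next≡) = subst (Linked q (corner m)) (sym next≡) (linked-around q (corner m))
            ... | inj₁ (arc≡ , next≡) = subst (Linked q (corner m))
                    (sym (trans next≡ (sym (across-agrees p q (corner m)
                      (agree m (edgeOf (corner m)) ≤-refl m<n (trans (cong (label G p) arc≡) (label-edgeArc p (corner m))))))))
                    (linked-across q (corner m))

    labelled-arc : ∀ w g → label G p (arc w) ≡ just g →
      arc w ≡ edgeArc p (corner w) × corner (suc w) ≡ across p (corner w) × edgeOf (corner w) ≡ g
    labelled-arc w g lab = labelled-joins p (arc w) (corner w) (corner (suc w)) g (joins w) lab

    only-two-arcs : ∀ i j g → i < j → j < N + i → label G p (arc i) ≡ just g → label G p (arc j) ≡ just g →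
      ∀ a → label G p a ≡ just g → a ≡ arc i ⊎ a ≡ arc j
    only-two-arcs i j g i<j j<N+i li lj a la
      with labelled-arc-shape p a g la | labelled-arc-shape p (arc i) g li | labelled-arc-shape p (arc j) g lj
    ... | k , refl | kᵢ , eᵢ | kⱼ , eⱼ with Fin2-pigeonhole k kᵢ kⱼ
    ...   | inj₁ refl        = inj₁ (sym eᵢ)
    ...   | inj₂ (inj₁ refl) = inj₂ (sym eⱼ)
    ...   | inj₂ (inj₂ refl) = ⊥-elim (arc-injective i j i<j j<N+i (trans eᵢ (sym eⱼ)))

    corners-of-edge : ∀ i j g → i < j → j < N + i → label G p (arc i) ≡ just g → label G p (arc j) ≡ just g →
      ∀ z → edgeOf z ≡ g → (z ≡ corner i ⊎ z ≡ corner (suc i)) ⊎ (z ≡ corner j ⊎ z ≡ corner (suc j))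
    corners-of-edge i j g i<j j<N+i li lj z z-on-g
      with only-two-arcs i j g i<j j<N+i li lj (edgeArc p z) (trans (label-edgeArc p z) (cong just z-on-g))
    ... | inj₁ eq = inj₁ (joins-endpoint p (arc i) z (across p z) (corner i) (corner (suc i))
                           (subst (λ a → Joins G p a z (across p z)) eq (edgeArc-joins p z)) (joins i))
    ... | inj₂ eq = inj₂ (joins-endpoint p (arc j) z (across p z) (corner j) (corner (suc j))
                           (subst (λ a → Joins G p a z (across p z)) eq (edgeArc-joins p z)) (joins j))

    label-≢ : ∀ i j g w → i < j → j < N + i → label G p (arc i) ≡ just g → label G p (arc j) ≡ just g →
      arc w ≢ arc i → arc w ≢ arc j → label G p (arc w) ≢ just g
    label-≢ i j g w i<j j<N+i li lj w≢i w≢j lw =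
      [ w≢i , w≢j ]′ (only-two-arcs i j g i<j j<N+i li lj (arc w) lw)

    no-visit-between : ∀ i j g → i < j → j < N + i → label G p (arc i) ≡ just g → label G p (arc j) ≡ just g →
      ∀ w → (i < w × w < j) ⊎ (j < w × w < N + i) → label G p (arc w) ≢ just g
    no-visit-between i j g i<j j<N+i li lj w (inj₁ (i<w , w<j)) =
      label-≢ i j g w i<j j<N+i li lj (arc-≢ i w i<w (<-trans w<j j<N+i)) (λ eq → arc-≢ w j w<j (<-trans j<N+i (+-monoʳ-< N i<w)) (sym eq))
    no-visit-between i j g i<j j<N+i li lj w (inj₂ (j<w , w<N+i)) =
      label-≢ i j g w i<j j<N+i li lj (arc-≢ i w (<-trans i<j j<w) w<N+i) (arc-≢ j w j<w (<-trans w<N+i (+-monoʳ-< N i<j)))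

    label-periodic : ∀ w → label G p (arc (N + w)) ≡ label G p (arc w)
    label-periodic w = cong (label G p) (arc-periodic w)

  module TwoVisits {p : Partition G} (T : Tour p) (e : Fin E) (k₁ k₂ : ℕ)
    (k₁<k₂ : k₁ < k₂) (k₂<N+k₁ : k₂ < Tour.N T + k₁)
    (lab₁ : label G p (Tour.arc T k₁) ≡ just e) (lab₂ : label G p (Tour.arc T k₂) ≡ just e) where
    open Tour T
    open TourFacts T

    tw : Bool
    tw = twist G e

    b₀ : Block
    b₀ = p e

    x₀ x₁ y₀ y₁ : Cnr
    x₀ = corner k₁
    x₁ = corner (suc k₁)
    y₀ = corner k₂
    y₁ = corner (suc k₂)

    x₀-on-e : edgeOf x₀ ≡ e
    x₀-on-e = proj₂ (proj₂ (labelled-arc k₁ e lab₁))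

    y₀-on-e : edgeOf y₀ ≡ e
    y₀-on-e = proj₂ (proj₂ (labelled-arc k₂ e lab₂))

    x₁≡ : x₁ ≡ acrossBlock tw b₀ x₀
    x₁≡ = trans (proj₁ (proj₂ (labelled-arc k₁ e lab₁))) (across-on p x₀ e x₀-on-e)

    y₁≡ : y₁ ≡ acrossBlock tw b₀ y₀
    y₁≡ = trans (proj₁ (proj₂ (labelled-arc k₂ e lab₂))) (across-on p y₀ e y₀-on-e)

    x₀≡ : x₀ ≡ acrossBlock tw b₀ x₁
    x₀≡ = trans (sym (acrossBlock-involutive tw b₀ x₀)) (cong (acrossBlock tw b₀) (sym x₁≡))

    x₁-on-e : edgeOf x₁ ≡ e
    x₁-on-e = trans (cong edgeOf x₁≡) (trans (edgeOf-acrossBlock tw b₀ x₀) x₀-on-e)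

    corners-of-e : ∀ z → edgeOf z ≡ e → (z ≡ x₀ ⊎ z ≡ x₁) ⊎ (z ≡ y₀ ⊎ z ≡ y₁)
    corners-of-e = corners-of-edge k₁ k₂ e k₁<k₂ k₂<N+k₁ lab₁ lab₂

    x₀≢y₀ : x₀ ≢ y₀
    x₀≢y₀ eq = arc-injective k₁ k₂ k₁<k₂ k₂<N+k₁
      (trans (proj₁ (labelled-arc k₁ e lab₁)) (trans (cong (edgeArc p) eq) (sym (proj₁ (labelled-arc k₂ e lab₂)))))

    x₁≢y₀ : x₁ ≢ y₀
    x₁≢y₀ eq = arc-injective k₁ k₂ k₁<k₂ k₂<N+k₁
      (trans (proj₁ (labelled-arc k₁ e lab₁)) (trans (sym (edgeArc-across p x₀))
        (trans (cong (edgeArc p) (trans (sym (proj₁ (proj₂ (labelled-arc k₁ e lab₁)))) eq))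
               (sym (proj₁ (labelled-arc k₂ e lab₂))))))

    -- Re-gluing e so that x₀ ↔ y₀ and x₁ ↔ y₁ reverses the segment between the visits but
    -- keeps one curve; re-gluing so that x₁ ↔ y₀ and x₀ ↔ y₁ cuts that segment off.
    keepBlock : Block
    keepBlock = proj₁ (acrossBlock-onto tw x₀ y₀ (trans x₀-on-e (sym y₀-on-e)) x₀≢y₀)

    keepBlock-x₀ : acrossBlock tw keepBlock x₀ ≡ y₀
    keepBlock-x₀ = proj₂ (acrossBlock-onto tw x₀ y₀ (trans x₀-on-e (sym y₀-on-e)) x₀≢y₀)

    keepBlock-x₁ : acrossBlock tw keepBlock x₁ ≡ y₁
    keepBlock-x₁ = trans (cong (acrossBlock tw keepBlock) x₁≡)
      (trans (acrossBlock-comm tw keepBlock b₀ x₀) (trans (cong (acrossBlock tw b₀) keepBlock-x₀) (sym y₁≡)))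

    splitBlock : Block
    splitBlock = proj₁ (acrossBlock-onto tw x₁ y₀ (trans x₁-on-e (sym y₀-on-e)) x₁≢y₀)

    splitBlock-x₁ : acrossBlock tw splitBlock x₁ ≡ y₀
    splitBlock-x₁ = proj₂ (acrossBlock-onto tw x₁ y₀ (trans x₁-on-e (sym y₀-on-e)) x₁≢y₀)

    splitBlock-x₀ : acrossBlock tw splitBlock x₀ ≡ y₁
    splitBlock-x₀ = trans (cong (acrossBlock tw splitBlock) x₀≡)
      (trans (acrossBlock-comm tw splitBlock b₀ x₁) (trans (cong (acrossBlock tw b₀) splitBlock-x₁) (sym y₁≡)))

    keepBlock≢b₀ : keepBlock ≢ b₀
    keepBlock≢b₀ eq = x₁≢y₀ (trans x₁≡ (trans (cong (λ b → acrossBlock tw b x₀) (sym eq)) keepBlock-x₀))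

    splitBlock≢b₀ : splitBlock ≢ b₀
    splitBlock≢b₀ eq = x₀≢y₀ (trans x₀≡ (trans (cong (λ b → acrossBlock tw b x₁) (sym eq)) splitBlock-x₁))

    keepBlock≢splitBlock : keepBlock ≢ splitBlock
    keepBlock≢splitBlock eq = across-moves p x₀ (trans (sym (proj₁ (proj₂ (labelled-arc k₁ e lab₁))))
      (acrossBlock-injective tw keepBlock (trans (trans (cong (λ b → acrossBlock tw b x₁) eq) splitBlock-x₁) (sym keepBlock-x₀))))

    remaining-block : ∀ b → b ≢ b₀ → b ≢ keepBlock → b ≡ splitBlock
    remaining-block b b≢b₀ b≢keep =
      blocks-exhausted (λ eq → keepBlock≢b₀ (sym eq)) keepBlock≢splitBlock (λ eq → splitBlock≢b₀ eq) b≢b₀ b≢keep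

    Inside : Cnr → Set
    Inside y = ∃ λ t → k₁ < t × t ≤ k₂ × corner t ≡ y

    KeepsInside : Fin E → Set
    KeepsInside g = ∀ x y → edgeOf x ≡ g → edgeOf y ≡ g → Inside x → Inside y

    t≤k₂⇒t<N+k₁ : ∀ {t} → t ≤ k₂ → t < N + k₁
    t≤k₂⇒t<N+k₁ t≤k₂ = ≤-<-trans t≤k₂ k₂<N+k₁

    x₀-outside : ¬ Inside x₀
    x₀-outside (zero , () , _)
    x₀-outside (suc t , k₁<t , t≤k₂ , eq)
      with arcs-at t (arc k₁) x₁ (subst (λ w → Joins G p (arc k₁) w x₁) (sym eq) (joins k₁))
    ... | inj₁ (a≡ , _) = arc-injective k₁ (suc t) k₁<t (t≤k₂⇒t<N+k₁ t≤k₂) a≡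
    ... | inj₂ (a≡ , x₁≡t) with m≤n⇒m<n∨m≡n (≤-pred k₁<t)
    ...   | inj₁ k₁<t′ = arc-injective k₁ t k₁<t′ (t≤k₂⇒t<N+k₁ (≤-trans (n≤1+n t) t≤k₂)) a≡
    ...   | inj₂ refl = joins-irreflexive p (arc k₁) x₀ (subst (Joins G p (arc k₁) x₀) x₁≡t (joins k₁))

    y₁-outside : ¬ Inside y₁
    y₁-outside (zero , () , _)
    y₁-outside (suc t , k₁<t , t≤k₂ , eq)
      with arcs-at t (arc k₂) y₀ (subst (λ w → Joins G p (arc k₂) w y₀) (sym eq) (joins-back k₂))
    ... | inj₂ (a≡ , _) = arc-injective t k₂ t≤k₂ (<-≤-trans k₂<N+k₁ (+-monoʳ-≤ N (≤-pred k₁<t))) (sym a≡)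
    ... | inj₁ (a≡ , y₀≡) with m≤n⇒m<n∨m≡n t≤k₂
    ...   | inj₁ t<k₂ = arc-injective (suc t) k₂ t<k₂ (<-≤-trans k₂<N+k₁ (+-monoʳ-≤ N (≤-trans (n≤1+n k₁) k₁<t))) (sym a≡)
    ...   | inj₂ refl = joins-irreflexive p (arc k₂) y₀ (subst (Joins G p (arc k₂) y₀) (sym y₀≡) (joins k₂))

    inside-step : ∀ a x y → label G p a ≢ just e → Joins G p a x y → Inside x → Inside y
    inside-step a x y not-e J (zero , () , _)
    inside-step a _ y not-e J (suc t , k₁<t , t≤k₂ , refl) with arcs-at t a y J
    ... | inj₁ (a≡ , y≡) with m≤n⇒m<n∨m≡n t≤k₂
    ...   | inj₁ t<k₂ = suc (suc t) , m<n⇒m<1+n k₁<t , t<k₂ , sym y≡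
    ...   | inj₂ refl = ⊥-elim (not-e (trans (cong (label G p) a≡) lab₂))
    inside-step a _ y not-e J (suc t , k₁<t , t≤k₂ , refl) | inj₂ (a≡ , y≡) with m≤n⇒m<n∨m≡n (≤-pred k₁<t)
    ...   | inj₁ k₁<t′ = t , k₁<t′ , ≤-trans (n≤1+n t) t≤k₂ , sym y≡
    ...   | inj₂ refl = ⊥-elim (not-e (trans (cong (label G p) a≡) lab₁))

    across-e : ∀ q b → q e ≡ b → ∀ z → edgeOf z ≡ e → across q z ≡ acrossBlock tw b z
    across-e q b qe≡b z z-on-e = trans (across-on q z e z-on-e) (cong (λ c → acrossBlock tw c z) qe≡b)

    -- x₁ is inside and x₀ is not, yet a basis would link them: the moves of q never leave
    -- the inside, since at e the split block only swaps x₁ and y₀.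
    split-not-basis : ∀ q → q e ≡ splitBlock → (∀ g → g ≢ e → q g ≡ p g ⊎ KeepsInside g) → ¬ InQ G q
    split-not-basis q qe≡split others q-basis =
      x₀-outside (linked-transport q Inside inside-across inside-around x₁⇝x₀ (suc k₁ , n<1+n k₁ , k₁<k₂ , refl))
      where
        x₁⇝x₀ : Linked q x₁ x₀
        x₁⇝x₀ = basis⇒linked q q-basis x₁ x₀
          (linked⇒sameComponent p (linked-sym (joins⇒linked p (arc k₁) x₀ x₁ (joins k₁))))
        inside-around : ∀ x → Inside x → Inside (around x)
        inside-around x = inside-step (vertexArc x) x (around x)
          (λ lab → nothing≢just (trans (sym (label-vertexArc p x)) lab)) (vertexArc-joins p x)
        across-q : ∀ z → edgeOf z ≡ e → across q z ≡ acrossBlock tw splitBlock z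
        across-q = across-e q splitBlock qe≡split
        inside-across : ∀ x → Inside x → Inside (across q x)
        inside-across x in-x with edgeOf x FP.≟ e
        ... | yes x-on-e with corners-of-e x x-on-e
        ...   | inj₁ (inj₁ refl) = ⊥-elim (x₀-outside in-x)
        ...   | inj₂ (inj₂ refl) = ⊥-elim (y₁-outside in-x)
        ...   | inj₁ (inj₂ refl) = k₂ , k₁<k₂ , ≤-refl , sym (trans (across-q x x-on-e) splitBlock-x₁)
        ...   | inj₂ (inj₁ refl) = suc k₁ , n<1+n k₁ , k₁<k₂ , sym (trans (across-q x x-on-e)
              (trans (cong (acrossBlock tw splitBlock) (sym splitBlock-x₁)) (acrossBlock-involutive tw splitBlock x₁)))
        inside-across x in-x | no x-off-e with others (edgeOf x) x-off-e
        ...   | inj₁ agree = subst Inside (sym (across-agrees p q x agree))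
                (inside-step (edgeArc p x) x (across p x)
                  (λ lab → x-off-e (just-injective (trans (sym (label-edgeArc p x)) lab))) (edgeArc-joins p x) in-x)
        ...   | inj₂ keeps = keeps x (across q x) refl (edgeOf-across q x) in-x

    x₁⇝y₀ : ∀ q → (∀ g → g ≢ e → q g ≡ p g) → Linked q x₁ y₀
    x₁⇝y₀ q agree = linked-along q (suc k₁) k₂ k₁<k₂ (λ w g k₁<w w<k₂ lab → agree g λ { refl →
      no-visit-between k₁ k₂ e k₁<k₂ k₂<N+k₁ lab₁ lab₂ w (inj₁ (k₁<w , w<k₂)) lab })

    keep-basis : ∀ q → q e ≡ keepBlock → (∀ g → g ≢ e → q g ≡ p g) → InQ G p → InQ G q
    keep-basis q qe≡keep agree p-basis = linked⇒basis p q p-basis λ x y xy →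
      linked-lift p q (_≡ e) (FP._≟ e) x₁ agree to-x₁ x y (basis⇒linked p p-basis x y xy)
      where
        across-q : ∀ z → edgeOf z ≡ e → across q z ≡ acrossBlock tw keepBlock z
        across-q = across-e q keepBlock qe≡keep
        to-x₁ : ∀ z → edgeOf z ≡ e → Linked q z x₁
        to-x₁ z z-on-e with corners-of-e z z-on-e
        ... | inj₁ (inj₁ refl) = linked-trans (subst (Linked q x₀) (trans (across-q x₀ x₀-on-e) keepBlock-x₀) (linked-across q x₀))
                                              (linked-sym (x₁⇝y₀ q agree))
        ... | inj₁ (inj₂ refl) = ε
        ... | inj₂ (inj₁ refl) = linked-sym (x₁⇝y₀ q agree)
        ... | inj₂ (inj₂ refl) = linked-sym (subst (Linked q x₁) (trans (across-q x₁ x₁-on-e) keepBlock-x₁) (linked-across q x₁))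

    module SplitAndSwitch (f : Fin E) (f≢e : f ≢ e) (r s : ℕ)
      (k₁<r : k₁ < r) (r<k₂ : r < k₂) (k₂<s : k₂ < s) (s<N+k₁ : s < N + k₁)
      (lab-r : label G p (arc r) ≡ just f) (lab-s : label G p (arc s) ≡ just f)
      (q : Partition G) (qe≡split : q e ≡ splitBlock) (qf≢pf : q f ≢ p f)
      (agree : ∀ g → g ≢ e → g ≢ f → q g ≡ p g) where

      r<s : r < s
      r<s = <-trans r<k₂ k₂<s

      s<N+r : s < N + r
      s<N+r = <-trans s<N+k₁ (+-monoʳ-< N k₁<r)

      e-free : ∀ w → (k₁ < w × w < k₂) ⊎ (k₂ < w × w < N + k₁) → label G p (arc w) ≢ just e
      e-free = no-visit-between k₁ k₂ e k₁<k₂ k₂<N+k₁ lab₁ lab₂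

      f-free : ∀ w → (r < w × w < s) ⊎ (s < w × w < N + r) → label G p (arc w) ≢ just f
      f-free = no-visit-between r s f r<s s<N+r lab-r lab-s

      linked-avoiding : ∀ m n → m ≤ n →
        (∀ w → m ≤ w → w < n → label G p (arc w) ≢ just e × label G p (arc w) ≢ just f) → Linked q (corner m) (corner n)
      linked-avoiding m n m≤n avoid = linked-along q m n m≤n λ w g m≤w w<n lab →
        agree g (λ { refl → proj₁ (avoid w m≤w w<n) lab }) (λ { refl → proj₂ (avoid w m≤w w<n) lab })

      x₁⇝r : Linked q x₁ (corner r)
      x₁⇝r = linked-avoiding (suc k₁) r k₁<r λ w k₁<w w<r →
        e-free w (inj₁ (k₁<w , <-trans w<r r<k₂)) ,
        λ lab → f-free (N + w) (inj₂ (<-trans s<N+k₁ (+-monoʳ-< N k₁<w) , +-monoʳ-< N w<r)) (trans (label-periodic w) lab)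

      r⇝y₀ : Linked q (corner (suc r)) y₀
      r⇝y₀ = linked-avoiding (suc r) k₂ r<k₂ λ w r<w w<k₂ →
        e-free w (inj₁ (<-trans k₁<r r<w , w<k₂)) , f-free w (inj₁ (r<w , <-trans w<k₂ k₂<s))

      y₁⇝s : Linked q y₁ (corner s)
      y₁⇝s = linked-avoiding (suc k₂) s k₂<s λ w k₂<w w<s →
        e-free w (inj₂ (k₂<w , <-trans w<s s<N+k₁)) , f-free w (inj₁ (<-trans r<k₂ k₂<w , w<s))

      s⇝x₀ : Linked q (corner (suc s)) x₀
      s⇝x₀ = subst (Linked q (corner (suc s))) (corner-periodic k₁)
        (linked-avoiding (suc s) (N + k₁) s<N+k₁ λ w s<w w<N+k₁ →
          e-free w (inj₂ (<-trans k₂<s s<w , w<N+k₁)) , f-free w (inj₂ (s<w , <-trans w<N+k₁ (+-monoʳ-< N k₁<r))))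

      across-q : ∀ z → edgeOf z ≡ e → across q z ≡ acrossBlock tw splitBlock z
      across-q = across-e q splitBlock qe≡split

      x₁⇝y₀-split : Linked q x₁ y₀
      x₁⇝y₀-split = subst (Linked q x₁) (trans (across-q x₁ x₁-on-e) splitBlock-x₁) (linked-across q x₁)

      x₀⇝y₁-split : Linked q x₀ y₁
      x₀⇝y₁-split = subst (Linked q x₀) (trans (across-q x₀ x₀-on-e) splitBlock-x₀) (linked-across q x₀)

      r-on-f : edgeOf (corner r) ≡ f
      r-on-f = proj₂ (proj₂ (labelled-arc r f lab-r))

      -- Switching f moves the far end of its arc at corner r from corner (r + 1) to a corner of
      -- the second visit of f, which bridges the two pieces into which the split cuts the curve.
      bridge : across q (corner r) ≡ corner s ⊎ across q (corner r) ≡ corner (suc s)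
      bridge with corners-of-edge r s f r<s s<N+r lab-r lab-s (across q (corner r)) (trans (edgeOf-across q (corner r)) r-on-f)
      ... | inj₂ at-s = at-s
      ... | inj₁ (inj₁ at-r) = ⊥-elim (across-moves q (corner r) at-r)
      ... | inj₁ (inj₂ at-r+1) = ⊥-elim (acrossBlock-≢ (twist G f) (q f) (p f) (corner r) qf≢pf
              (trans (sym (across-on q (corner r) f r-on-f))
                (trans at-r+1 (trans (proj₁ (proj₂ (labelled-arc r f lab-r))) (across-on p (corner r) f r-on-f)))))

      visit-s⇝y₁ : ∀ z → z ≡ corner s ⊎ z ≡ corner (suc s) → Linked q z y₁
      visit-s⇝y₁ z (inj₁ refl) = linked-sym y₁⇝s
      visit-s⇝y₁ z (inj₂ refl) = linked-trans s⇝x₀ x₀⇝y₁-split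

      y₁⇝x₁ : Linked q y₁ x₁
      y₁⇝x₁ = linked-trans (linked-sym (visit-s⇝y₁ _ bridge))
                (linked-trans (linked-sym (linked-across q (corner r))) (linked-sym x₁⇝r))

      e-or-f? : ∀ g → Dec (g ≡ e ⊎ g ≡ f)
      e-or-f? g with g FP.≟ e | g FP.≟ f
      ... | yes g≡e | _       = yes (inj₁ g≡e)
      ... | no _    | yes g≡f = yes (inj₂ g≡f)
      ... | no g≢e  | no g≢f  = no [ g≢e , g≢f ]′

      to-x₁ : ∀ z → edgeOf z ≡ e ⊎ edgeOf z ≡ f → Linked q z x₁
      to-x₁ z (inj₁ z-on-e) with corners-of-e z z-on-e
      ... | inj₁ (inj₁ refl) = linked-trans x₀⇝y₁-split y₁⇝x₁
      ... | inj₁ (inj₂ refl) = ε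
      ... | inj₂ (inj₁ refl) = linked-sym x₁⇝y₀-split
      ... | inj₂ (inj₂ refl) = y₁⇝x₁
      to-x₁ z (inj₂ z-on-f) with corners-of-edge r s f r<s s<N+r lab-r lab-s z z-on-f
      ... | inj₁ (inj₁ refl) = linked-sym x₁⇝r
      ... | inj₁ (inj₂ refl) = linked-trans r⇝y₀ (linked-sym x₁⇝y₀-split)
      ... | inj₂ at-s        = linked-trans (visit-s⇝y₁ z at-s) y₁⇝x₁

      split-and-switch-basis : InQ G p → InQ G q
      split-and-switch-basis p-basis = linked⇒basis p q p-basis λ x y xy →
        linked-lift p q (λ g → g ≡ e ⊎ g ≡ f) e-or-f? x₁ (λ g ¬e-or-f → agree g (λ eq → ¬e-or-f (inj₁ eq)) (λ eq → ¬e-or-f (inj₂ eq)))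
          to-x₁ x y (basis⇒linked p p-basis x y xy)

  _≟C_ : DecidableEquality Cnr
  _≟C_ = PP.≡-dec (PP.≡-dec FP._≟_ FP._≟_) FP._≟_

  encode : Cnr → Fin ((E ℕ.* 2) ℕ.* 2)
  encode ((e , j) , k) = combine (combine e j) k

  encode-injective : Injective _≡_ _≡_ encode
  encode-injective {(e , j) , k} {(e′ , j′) , k′} eq with combine-injective (combine e j) k (combine e′ j′) k′ eq
  ... | ej≡ , refl with combine-injective e j e′ j′ ej≡
  ...   | refl , refl = refl

  module TourFrom (p : Partition G) (x₀ : Cnr) where
    step : Cnr → Cnr
    step x = around (across p x)

    step-injective : Injective _≡_ _≡_ step
    step-injective {x} {y} eq = trans (sym (across-involutive p x))
      (trans (cong (across p) (trans (sym (around-involutive _)) (trans (cong around eq) (around-involutive _))))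
             (across-involutive p y))

    orbit : ℕ → Cnr
    orbit n = iter step n x₀

    steps-across : ∀ k y → iter step k (across p (iter step k y)) ≡ across p y
    steps-across zero y = refl
    steps-across (suc k) y =
      trans (cong (λ w → step (iter step k (across p w))) (sym (iter-commute step k y)))
        (trans (cong step (steps-across k (step y)))
               (trans (cong around (across-involutive p (around (across p y)))) (around-involutive (across p y))))

    reflection-reached : ∀ m n → orbit n ≡ across p (orbit m) → iter step (m + n) x₀ ≡ across p x₀
    reflection-reached m n hit = trans (iter-+ step m n x₀) (trans (cong (iter step m) hit) (steps-across m x₀))

    -- Halfway to its reflection the orbit would hit a fixed point of across (even
    -- distance) or of around (odd distance).
    orbit-not-reflected : ∀ m n → orbit n ≢ across p (orbit m)
    orbit-not-reflected m n hit with even-or-odd (m + n)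
    ... | d , inj₁ m+n≡d+d = across-moves p (orbit d) (sym (iter-injective step step-injective d
          (trans (sym (iter-+ step d d x₀)) (trans (cong (λ w → iter step w x₀) (sym m+n≡d+d))
            (trans (reflection-reached m n hit) (sym (steps-across d x₀)))))))
    ... | d , inj₂ m+n≡d+d+1 = around-moves (across p (orbit d)) (iter-injective step step-injective d
          (trans (iter-commute step d (orbit d)) (trans (cong step (sym (iter-+ step d d x₀)))
            (trans (cong (λ w → iter step w x₀) (sym m+n≡d+d+1))
              (trans (reflection-reached m n hit) (sym (steps-across d x₀)))))))

    returns : ∃ λ d → 0 < d × orbit d ≡ x₀
    returns with pigeonhole (n<1+n ((E ℕ.* 2) ℕ.* 2)) (λ i → encode (orbit (toℕ i)))
    ... | i , j , i<j , eq = toℕ j ∸ toℕ i , m<n⇒0<n∸m i<j , sym (iter-injective step step-injective (toℕ i)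
          (trans (encode-injective eq) (trans (cong (λ w → iter step w x₀) (sym (m+[n∸m]≡n (<⇒≤ i<j))))
                                              (iter-+ step (toℕ i) _ x₀))))

    abstract
      first-return : ∃ λ k → orbit (suc k) ≡ x₀ × ∀ j → j < k → orbit (suc j) ≢ x₀
      first-return with returns
      ... | suc d , _ , back = least-witness (λ k → orbit (suc k) ≟C x₀) d back

    L : ℕ
    L = suc (proj₁ first-return)

    orbit-L : orbit L ≡ x₀
    orbit-L = proj₁ (proj₂ first-return)

    returns-late : ∀ d → 0 < d → d < L → orbit d ≢ x₀
    returns-late (suc d) _ d<L = proj₂ (proj₂ first-return) d (≤-pred d<L)

    orbit-distinct : ∀ m m′ → m < m′ → m′ < L + m → orbit m′ ≢ orbit m
    orbit-distinct m m′ m<m′ m′<L+m eq = returns-late (m′ ∸ m) (m<n⇒0<n∸m m<m′)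
      (subst (m′ ∸ m <_) (m+n∸n≡m L m) (∸-monoˡ-< m′<L+m (<⇒≤ m<m′)))
      (iter-injective step step-injective m
        (trans (sym (iter-+ step m (m′ ∸ m) x₀)) (trans (cong (λ w → iter step w x₀) (m+[n∸m]≡n (<⇒≤ m<m′))) eq)))

    -- A walk state records whether the next arc to follow is the edge arc (false) or the vertex arc (true).
    walk : Cnr × Bool → Cnr × Bool
    walk (x , false) = across p x , true
    walk (x , true)  = around x , false

    arcOf : Cnr × Bool → Arc₀
    arcOf (x , false) = edgeArc p x
    arcOf (x , true)  = vertexArc x

    walk-joins : ∀ w → Joins G p (arcOf w) (proj₁ w) (proj₁ (walk w))
    walk-joins (x , false) = edgeArc-joins p x
    walk-joins (x , true)  = vertexArc-joins p x

    state : ℕ → Cnr × Bool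
    state n = iter walk n (x₀ , false)

    state-even : ∀ d → state (d + d) ≡ (orbit d , false)
    state-even zero    = refl
    state-even (suc d) = trans (cong (λ w → state (suc w)) (+-suc d d)) (cong (λ w → walk (walk w)) (state-even d))

    state-odd : ∀ d → state (suc (d + d)) ≡ (across p (orbit d) , true)
    state-odd d = cong walk (state-even d)

    state-periodic : ∀ n → state ((L + L) + n) ≡ state n
    state-periodic n = trans (cong state (+-comm (L + L) n))
      (trans (iter-+ walk n (L + L) _) (cong (iter walk n) (trans (state-even L) (cong (_, false) orbit-L))))

    halves : ∀ m m′ → m + m < m′ + m′ → m′ + m′ < (L + L) + (m + m) → m < m′ × m′ < L + m
    halves m m′ lt lt′ = m+m<n+n⇒m<n lt , m+m<n+n⇒m<n (subst (m′ + m′ <_) (interchange +-commutativeSemigroup L L m m) lt′)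

    edgeArcs-distinct : ∀ m m′ → m < m′ → m′ < L + m → edgeArc p (orbit m) ≢ edgeArc p (orbit m′)
    edgeArcs-distinct m m′ m<m′ m′<L+m eq with edgeArc-injective p _ _ eq
    ... | inj₁ same      = orbit-distinct m m′ m<m′ m′<L+m same
    ... | inj₂ reflected = orbit-not-reflected m m′ reflected

    vertexArcs-distinct : ∀ m m′ → m < m′ → m′ < L + m →
      vertexArc (across p (orbit m)) ≢ vertexArc (across p (orbit m′))
    vertexArcs-distinct m m′ m<m′ m′<L+m eq with vertexArc-injective p _ _ eq
    ... | inj₁ same = orbit-distinct m m′ m<m′ m′<L+m
          (trans (sym (across-involutive p _)) (trans (cong (across p) same) (across-involutive p _)))
    ... | inj₂ next = orbit-not-reflected (suc m) m′ (trans (sym (across-involutive p _)) (cong (across p) next))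

    walk-arcs-distinct : ∀ i j → i < j → j < (L + L) + i → arcOf (state i) ≢ arcOf (state j)
    walk-arcs-distinct i j = by-parity i j (even-or-odd i) (even-or-odd j)
      where
        by-parity : ∀ i j → (∃ λ d → i ≡ d + d ⊎ i ≡ suc (d + d)) → (∃ λ d → j ≡ d + d ⊎ j ≡ suc (d + d)) →
          i < j → j < (L + L) + i → arcOf (state i) ≢ arcOf (state j)
        by-parity _ _ (m , inj₁ refl) (m′ , inj₁ refl) i<j j<N+i eq =
          let (m<m′ , m′<L+m) = halves m m′ i<j j<N+i in
          edgeArcs-distinct m m′ m<m′ m′<L+m (trans (sym (cong arcOf (state-even m))) (trans eq (cong arcOf (state-even m′))))
        by-parity _ _ (m , inj₂ refl) (m′ , inj₂ refl) i<j j<N+i eq =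
          let (m<m′ , m′<L+m) = halves m m′ (≤-pred i<j) (≤-pred (subst (suc (m′ + m′) <_) (+-suc (L + L) (m + m)) j<N+i)) in
          vertexArcs-distinct m m′ m<m′ m′<L+m (trans (sym (cong arcOf (state-odd m))) (trans eq (cong arcOf (state-odd m′))))
        by-parity _ _ (m , inj₁ refl) (m′ , inj₂ refl) _ _ eq =
          edgeArc≢vertexArc p _ _ (trans (sym (cong arcOf (state-even m))) (trans eq (cong arcOf (state-odd m′))))
        by-parity _ _ (m , inj₂ refl) (m′ , inj₁ refl) _ _ eq =
          edgeArc≢vertexArc p _ _ (sym (trans (sym (cong arcOf (state-odd m))) (trans eq (cong arcOf (state-even m′)))))

    tour : Tour p
    tour = record
      { N               = L + L
      ; N≥2             = +-mono-≤ (s≤s z≤n) (s≤s z≤n)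
      ; arc             = λ n → arcOf (state n)
      ; corner          = λ n → proj₁ (state n)
      ; joins           = λ n → walk-joins (state n)
      ; arc-periodic    = λ n → cong arcOf (state-periodic n)
      ; corner-periodic = λ n → cong proj₁ (state-periodic n)
      ; arc-injective   = walk-arcs-distinct
      }

  module TrailTour (p : Partition G) (tr : ClosedTrail G p) where
    open ClosedTrail tr renaming (arc to trail-arc; corner to trail-corner; joins to trail-joins)

    position : ℕ → Fin (suc len)
    position zero    = zero
    position (suc n) = csuc (position n)

    toℕ-position : ∀ n → toℕ (position n) ≡ n % suc len
    toℕ-position zero    = refl
    toℕ-position (suc n) =
      trans (toℕ-fromℕ< _) (trans (cong (λ w → suc w % suc len) (toℕ-position n)) (suc[m%n]%n≡suc[m]%n n len))

    position-periodic : ∀ n → position (suc len + n) ≡ position n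
    position-periodic n = toℕ-injective (trans (toℕ-position (suc len + n))
      (trans (cong (_% suc len) (+-comm (suc len) n)) (trans ([m+n]%n≡m%n n (suc len)) (sym (toℕ-position n)))))

    position-toℕ : ∀ i → position (toℕ i) ≡ i
    position-toℕ i = toℕ-injective (trans (toℕ-position (toℕ i)) (m<n⇒m%n≡m (toℕ<n i)))

    1≤len : 1 ≤ len
    1≤len with len in eq
    ... | zero = ⊥-elim (joins-irreflexive p (trail-arc zero) (trail-corner zero)
                  (subst (λ i → Joins G p (trail-arc zero) (trail-corner zero) (trail-corner i)) (csuc-zero eq) (trail-joins zero)))
      where
        csuc-zero : len ≡ 0 → csuc {len} zero ≡ zero
        csuc-zero refl = refl
    ... | suc _ = s≤s z≤n

    tour : Tour p
    tour = record
      { N               = suc len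
      ; N≥2             = s≤s 1≤len
      ; arc             = λ n → trail-arc (position n)
      ; corner          = λ n → trail-corner (position n)
      ; joins           = λ n → trail-joins (position n)
      ; arc-periodic    = λ n → cong trail-arc (position-periodic n)
      ; corner-periodic = λ n → cong trail-corner (position-periodic n)
      ; arc-injective   = λ i j i<j j<N+i eq → [d+i]%n≢i%n len i (j ∸ i) (m<n⇒0<n∸m i<j)
          (subst (j ∸ i <_) (m+n∸n≡m (suc len) i) (∸-monoˡ-< j<N+i (<⇒≤ i<j)))
          (sym (trans (sym (toℕ-position i)) (trans (cong toℕ (arc-inj _ _ eq))
            (trans (toℕ-position j) (cong (_% suc len) (sym (m∸n+n≡m (<⇒≤ i<j))))))))
      }

  module TourTrail {p : Partition G} (T : Tour p) where
    open Tour T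

    len : ℕ
    len = ℕ.pred N

    1+len≡N : suc len ≡ N
    1+len≡N = pred-inverse N N≥2
      where
        pred-inverse : ∀ n → 2 ≤ n → suc (ℕ.pred n) ≡ n
        pred-inverse (suc n) _ = refl

    corner-csuc : ∀ i → corner (toℕ (csuc i)) ≡ corner (suc (toℕ i))
    corner-csuc i with m≤n⇒m<n∨m≡n (toℕ<n i)
    ... | inj₁ lt = cong corner (trans (toℕ-fromℕ< _) (m<n⇒m%n≡m lt))
    ... | inj₂ eq = trans (cong corner (trans (toℕ-fromℕ< _) (trans (cong (_% suc len) eq) (n%n≡0 (suc len)))))
                          (sym (trans (cong corner (trans eq (trans 1+len≡N (sym (+-identityʳ N))))) (corner-periodic 0)))

    toℕ<N : ∀ (i : Fin (suc len)) → toℕ i < N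
    toℕ<N i = subst (toℕ i <_) 1+len≡N (toℕ<n i)

    trail : ClosedTrail G p
    trail = record
      { len     = len
      ; arc     = λ i → arc (toℕ i)
      ; corner  = λ i → corner (toℕ i)
      ; arc-inj = distinct
      ; joins   = λ i → subst (Joins G p (arc (toℕ i)) (corner (toℕ i))) (sym (corner-csuc i)) (joins (toℕ i))
      }
      where
        distinct : ∀ i j → arc (toℕ i) ≡ arc (toℕ j) → i ≡ j
        distinct i j eq with <-cmp (toℕ i) (toℕ j)
        ... | tri< lt _ _ = ⊥-elim (arc-injective (toℕ i) (toℕ j) lt (≤-trans (toℕ<N j) (m≤m+n N (toℕ i))) eq)
        ... | tri≈ _ eq′ _ = toℕ-injective eq′
        ... | tri> _ _ gt = ⊥-elim (arc-injective (toℕ j) (toℕ i) gt (≤-trans (toℕ<N i) (m≤m+n N (toℕ j))) (sym eq))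

-- The fundamental circuit of an edge

module FundamentalCircuit (G : RibbonGraph) where
  open Boundary G
  open Tours G

  update : Partition G → Fin E → Block → Partition G
  update p g b h with h FP.≟ g
  ... | yes _ = b
  ... | no _  = p h

  update-at : ∀ p g b → update p g b g ≡ b
  update-at p g b with g FP.≟ g
  ... | yes _ = refl
  ... | no g≢g = ⊥-elim (g≢g refl)

  update-≢ : ∀ p g b h → h ≢ g → update p g b h ≡ p h
  update-≢ p g b h h≢g with h FP.≟ g
  ... | yes h≡g = ⊥-elim (h≢g h≡g)
  ... | no _    = refl

  module Visits {p : Partition G} (T : Tour p) (p-basis : InQ G p) where
    open Tour T
    open TourFacts T

    Visited : Cnr → Set
    Visited y = ∃ λ t → 1 ≤ t × t ≤ N × corner t ≡ y

    corner-N : corner N ≡ corner 0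
    corner-N = trans (cong corner (sym (+-identityʳ N))) (corner-periodic 0)

    arc-N : arc N ≡ arc 0
    arc-N = trans (cong arc (sym (+-identityʳ N))) (arc-periodic 0)

    visited-step : ∀ a x y → Joins G p a x y → Visited x → Visited y
    visited-step a x y J (zero , () , _)
    visited-step a _ y J (suc t , _ , t<N , refl) with arcs-at t a y J
    ... | inj₁ (_ , y≡) with m≤n⇒m<n∨m≡n t<N
    ...   | inj₁ t+1<N = suc (suc t) , s≤s z≤n , t+1<N , sym y≡
    ...   | inj₂ refl  = 1 , ≤-refl , ≤-trans (s≤s z≤n) t<N , sym (trans y≡ (trans (cong corner (+-comm 1 N)) (corner-periodic 1)))
    visited-step a _ y J (suc t , _ , t<N , refl) | inj₂ (_ , y≡) with t
    ... | zero   = N , ≤-trans (s≤s z≤n) t<N , ≤-refl , trans corner-N (sym y≡)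
    ... | suc t′ = suc t′ , s≤s z≤n , ≤-trans (n≤1+n _) t<N , sym y≡

    -- In a basis the curve through corner 0 is the only one in its component.
    all-visited : ∀ y → SameComponent (vertexOfCorner (corner 0)) (vertexOfCorner y) → Visited y
    all-visited y same = linked-transport p Visited
      (λ x → visited-step (edgeArc p x) x (across p x) (edgeArc-joins p x))
      (λ x → visited-step (vertexArc x) x (around x) (vertexArc-joins p x))
      (basis⇒linked p p-basis (corner 0) y same) (N , ≤-trans (s≤s z≤n) N≥2 , ≤-refl , corner-N)

    edgeArc-index : ∀ t → 1 ≤ t →
      ∃ λ u → u ≤ t × arc u ≡ edgeArc p (corner t) × (corner u ≡ corner t ⊎ corner (suc u) ≡ corner t)
    edgeArc-index (suc t) _ with arcs-at t (edgeArc p (corner (suc t))) _ (edgeArc-joins p (corner (suc t)))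
    ... | inj₁ (a≡ , _) = suc t , ≤-refl , sym a≡ , inj₁ refl
    ... | inj₂ (a≡ , _) = t , n≤1+n t , sym a≡ , inj₂ refl

    index-inside : ∀ u → u ≤ N → arc u ≢ arc 0 → 0 < u × u < N
    index-inside u u≤N u≢0 = n≢0⇒n>0 (λ { refl → u≢0 refl }) , ≤∧≢⇒< u≤N (λ { refl → u≢0 arc-N })

    -- Reglued by another block, x gives a corner of the same edge whose edge arc is not arc 0;
    -- it lies on the tour, so its edge arc is a second visit of the edge.
    second-visit : ∀ x → arc 0 ≡ edgeArc p x → corner 0 ≡ x →
      ∃ λ k → 0 < k × k < N × label G p (arc k) ≡ just (edgeOf x)
    second-visit x arc-0 corner-0 = from-visit (all-visited x′ x′-reached)
      where
        tw : Bool
        tw = twist G (edgeOf x)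
        b′ : Block
        b′ = anotherBlock (p (edgeOf x))
        x′ : Cnr
        x′ = acrossBlock tw b′ x
        x′-on-e : edgeOf x′ ≡ edgeOf x
        x′-on-e = edgeOf-acrossBlock tw b′ x
        x′-reached : SameComponent (vertexOfCorner (corner 0)) (vertexOfCorner x′)
        x′-reached = subst (λ c → SameComponent (vertexOfCorner c) (vertexOfCorner x′)) (sym corner-0)
                       (sameEdge⇒sameComponent x x′ (sym x′-on-e))
        edgeArc-x′≢ : edgeArc p x′ ≢ edgeArc p x
        edgeArc-x′≢ eq with edgeArc-injective p x x′ (sym eq)
        ... | inj₁ same    = acrossBlock-moves tw b′ x same
        ... | inj₂ crossed = acrossBlock-≢ tw b′ (p (edgeOf x)) x (anotherBlock-≢ (p (edgeOf x))) crossed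
        at-index : ∀ u → u ≤ N → arc u ≡ edgeArc p x′ → ∃ λ k → 0 < k × k < N × label G p (arc k) ≡ just (edgeOf x)
        at-index u u≤N arc-u = u , proj₁ inside , proj₂ inside ,
                               trans (cong (label G p) arc-u) (trans (label-edgeArc p x′) (cong just x′-on-e))
          where
            inside : 0 < u × u < N
            inside = index-inside u u≤N (λ eq → edgeArc-x′≢ (trans (sym arc-u) (trans eq arc-0)))
        from-visit : Visited x′ → ∃ λ k → 0 < k × k < N × label G p (arc k) ≡ just (edgeOf x)
        from-visit (t , 1≤t , t≤N , ct≡) =
          let (u , u≤t , a≡ , _) = edgeArc-index t 1≤t in at-index u (≤-trans u≤t t≤N) (trans a≡ (cong (edgeArc p) ct≡))

  module ForEdge (p : Partition G) (p-basis : InQ G p) (e : Fin E) where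
    start : Cnr
    start = (e , zero) , zero

    -- Abstract, so that types mentioning the tour are never normalised through its construction.
    abstract
      T : Tour p
      T = TourFrom.tour p start

      arc-0 : Tour.arc T 0 ≡ edgeArc p start
      arc-0 = refl

      corner-0 : Tour.corner T 0 ≡ start
      corner-0 = refl

    open Tour T
    open TourFacts T
    open Visits T p-basis

    lab-0 : label G p (arc 0) ≡ just e
    lab-0 = trans (cong (label G p) arc-0) (label-edgeArc p start)

    labels-≢ : ∀ u v g h → label G p (arc u) ≡ just g → label G p (arc v) ≡ just h → g ≢ h → arc u ≢ arc v
    labels-≢ u v g h lu lv g≢h eq = g≢h (just-injective (trans (sym lu) (trans (cong (label G p) eq) lv)))

    abstract
      second : ∃ λ k₂ → 0 < k₂ × k₂ < N × label G p (arc k₂) ≡ just e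
      second = second-visit start arc-0 corner-0

    k₂ : ℕ
    k₂ = proj₁ second

    0<k₂ : 0 < k₂
    0<k₂ = proj₁ (proj₂ second)

    k₂<N : k₂ < N
    k₂<N = proj₁ (proj₂ (proj₂ second))

    lab-k₂ : label G p (arc k₂) ≡ just e
    lab-k₂ = proj₂ (proj₂ (proj₂ second))

    open TwoVisits T e 0 k₂ 0<k₂ (subst (k₂ <_) (sym (+-identityʳ N)) k₂<N) lab-0 lab-k₂

    Crosses : Fin E → Set
    Crosses f = (∃ λ r → 0 < r × r < k₂ × label G p (arc r) ≡ just f) ×
                (∃ λ s → k₂ < s × s < N × label G p (arc s) ≡ just f)

    labelled? : ∀ f n → Dec (label G p (arc n) ≡ just f)
    labelled? f n = MaybeP.≡-dec FP._≟_ (label G p (arc n)) (just f)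

    crosses? : ∀ f → Dec (Crosses f)
    crosses? f with anyUpTo? (λ r → 0 <? r ×-dec labelled? f r) k₂ | anyUpTo? (λ s → k₂ <? s ×-dec labelled? f s) N
    ... | yes (r , r<k₂ , 0<r , lr) | yes (s , s<N , k₂<s , ls) = yes ((r , 0<r , r<k₂ , lr) , (s , k₂<s , s<N , ls))
    ... | no none | _ = no λ { ((r , 0<r , r<k₂ , lr) , _) → none (r , r<k₂ , 0<r , lr) }
    ... | yes _ | no none = no λ { (_ , (s , k₂<s , s<N , ls)) → none (s , s<N , k₂<s , ls) }

    index-of : ∀ t g → 1 ≤ t → t ≤ N → edgeOf (corner t) ≡ g → g ≢ e →
      ∃ λ u → 0 < u × u < N × u ≤ t × u ≢ k₂ × label G p (arc u) ≡ just g ×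
        (corner u ≡ corner t ⊎ corner (suc u) ≡ corner t)
    index-of t g 1≤t t≤N on-g g≢e =
      let (u , u≤t , a≡ , at-t) = edgeArc-index t 1≤t
          lab : label G p (arc u) ≡ just g
          lab = trans (cong (label G p) a≡) (trans (label-edgeArc p (corner t)) (cong just on-g))
          (0<u , u<N) = index-inside u (≤-trans u≤t t≤N) (labels-≢ u 0 g e lab lab-0 g≢e)
      in u , 0<u , u<N , u≤t , (λ eq → labels-≢ u k₂ g e lab lab-k₂ g≢e (cong arc eq)) , lab , at-t

    -- Both visits of g then lie between the visits of e, so all corners of g are inside.
    not-crossing⇒keeps-inside : ∀ g → g ≢ e → ¬ Crosses g → KeepsInside g
    not-crossing⇒keeps-inside g g≢e no-cross x y x-on-g y-on-g (t , 0<t , t≤k₂ , refl) =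
      let (u , 0<u , _ , u≤t , u≢k₂ , lab-u , _) = index-of t g 0<t (≤-trans t≤k₂ (<⇒≤ k₂<N)) x-on-g g≢e
          u<k₂ : u < k₂
          u<k₂ = ≤∧≢⇒< (≤-trans u≤t t≤k₂) u≢k₂
          (t′ , 1≤t′ , t′≤N , ct′≡y) = all-visited y (linked⇒sameComponent p
             (linked-trans (linked-along p 0 t z≤n (λ _ _ _ _ _ → refl))
               (basis⇒linked p p-basis (corner t) y (sameEdge⇒sameComponent (corner t) y (trans x-on-g (sym y-on-g))))))
          (u′ , 0<u′ , u′<N , _ , u′≢k₂ , lab-u′ , at-y) = index-of t′ g 1≤t′ t′≤N (trans (cong edgeOf ct′≡y) y-on-g) g≢e
      in inside-at u′ (u′<k₂ u′ 0<u′ u′<N u′≢k₂ lab-u′ (no-cross ∘ ((u , 0<u , u<k₂ , lab-u) ,_))) 0<u′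
           (subst (λ c → corner u′ ≡ c ⊎ corner (suc u′) ≡ c) ct′≡y at-y)
      where
        u′<k₂ : ∀ u′ → 0 < u′ → u′ < N → u′ ≢ k₂ → label G p (arc u′) ≡ just g →
          ¬ (∃ λ s → k₂ < s × s < N × label G p (arc s) ≡ just g) → u′ < k₂
        u′<k₂ u′ _ u′<N u′≢k₂ lab ¬after with <-cmp u′ k₂
        ... | tri< lt _ _  = lt
        ... | tri≈ _ eq _  = ⊥-elim (u′≢k₂ eq)
        ... | tri> _ _ gt  = ⊥-elim (¬after (u′ , gt , u′<N , lab))
        inside-at : ∀ u → u < k₂ → 0 < u → corner u ≡ y ⊎ corner (suc u) ≡ y → Inside y
        inside-at u u<k₂ 0<u (inj₁ at) = u , 0<u , <⇒≤ u<k₂ , at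
        inside-at u u<k₂ 0<u (inj₂ at) = suc u , s≤s z≤n , u<k₂ , at

    split-not-basis′ : ∀ B → InQ G B → B e ≡ splitBlock → (∀ g → g ≢ e → Crosses g → B g ≡ p g) → ⊥
    split-not-basis′ B B-basis Be≡split agree = split-not-basis B Be≡split others B-basis
      where
        others : ∀ g → g ≢ e → B g ≡ p g ⊎ KeepsInside g
        others g g≢e with crosses? g
        ... | yes cross    = inj₁ (agree g g≢e cross)
        ... | no  no-cross = inj₂ (not-crossing⇒keeps-inside g g≢e no-cross)

    switched : Fin E → Partition G
    switched g = update (update p e splitBlock) g (anotherBlock (p g))

    switched-e : ∀ g → g ≢ e → switched g e ≡ splitBlock
    switched-e g g≢e = trans (update-≢ _ g _ e (λ eq → g≢e (sym eq))) (update-at p e splitBlock)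

    switched-other : ∀ g h → h ≢ e → h ≢ g → switched g h ≡ p h
    switched-other g h h≢e h≢g = trans (update-≢ _ g _ h h≢g) (update-≢ p e splitBlock h h≢e)

    switched-basis : ∀ g → g ≢ e → Crosses g → InQ G (switched g)
    switched-basis g g≢e ((r , 0<r , r<k₂ , lr) , (s , k₂<s , s<N , ls)) =
      SplitAndSwitch.split-and-switch-basis g g≢e r s 0<r r<k₂ k₂<s (subst (s <_) (sym (+-identityʳ N)) s<N) lr ls
        (switched g) (switched-e g g≢e) (λ eq → anotherBlock-≢ (p g) (trans (sym (update-at _ g _)) eq))
        (λ h h≢e h≢g → switched-other g h h≢e h≢g) p-basis

    kept-basis : InQ G (update p e keepBlock)
    kept-basis = keep-basis (update p e keepBlock) (update-at p e keepBlock) (update-≢ p e keepBlock) p-basis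

    open MM (InQ G)

    ⊆p⇒independent : ∀ S → (∀ f b → S f ≡ just b → b ≡ p f) → ¬ Dependent S
    ⊆p⇒independent S S⊆p = ⊆basis⇒independent (InQ G) p S p-basis (λ f b Sf → sym (S⊆p f b Sf))

    ⊆switched⇒independent : ∀ S g → g ≢ e → Crosses g → S g ≡ nothing →
      (∀ f b → S f ≡ just b → f ≢ g → f ≡ e × b ≡ splitBlock ⊎ f ≢ e × b ≡ p f) → ¬ Dependent S
    ⊆switched⇒independent S g g≢e cross Sg≡nothing entries =
      ⊆basis⇒independent (InQ G) (switched g) S (switched-basis g g≢e cross) S⊆switched
      where
        S⊆switched : ∀ f b → S f ≡ just b → switched g f ≡ b
        S⊆switched f b Sf = by-cases (f FP.≟ g)
          where
            by-cases : Dec (f ≡ g) → switched g f ≡ b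
            by-cases (yes refl) = ⊥-elim (nothing≢just (trans (sym Sg≡nothing) Sf))
            by-cases (no f≢g) with entries f b Sf f≢g
            ... | inj₁ (f≡e , b≡split) = trans (cong (switched g) f≡e) (trans (switched-e g g≢e) (sym b≡split))
            ... | inj₂ (f≢e , b≡pf)    = trans (switched-other g f f≢e f≢g) (sym b≡pf)

    circuitEntry : ∀ g → Dec (g ≡ e) → Dec (Crosses g) → Maybe Block
    circuitEntry g (yes _) _       = just splitBlock
    circuitEntry g (no _)  (yes _) = just (p g)
    circuitEntry g (no _)  (no _)  = nothing

    C₀ : Subtransversal
    C₀ g = circuitEntry g (g FP.≟ e) (crosses? g)

    C₀-e : C₀ e ≡ just splitBlock
    C₀-e with e FP.≟ e
    ... | yes _   = refl
    ... | no e≢e  = ⊥-elim (e≢e refl)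

    C₀-crossing : ∀ g → g ≢ e → Crosses g → C₀ g ≡ just (p g)
    C₀-crossing g g≢e cross with g FP.≟ e | crosses? g
    ... | yes g≡e | _         = ⊥-elim (g≢e g≡e)
    ... | no _    | yes _     = refl
    ... | no _    | no ¬cross = ⊥-elim (¬cross cross)

    C₀-other : ∀ g → g ≢ e → ¬ Crosses g → C₀ g ≡ nothing
    C₀-other g g≢e ¬cross with g FP.≟ e | crosses? g
    ... | yes g≡e | _       = ⊥-elim (g≢e g≡e)
    ... | no _    | yes cross = ⊥-elim (¬cross cross)
    ... | no _    | no _    = refl

    C₀-entries : ∀ g b → C₀ g ≡ just b → g ≡ e × b ≡ splitBlock ⊎ g ≢ e × Crosses g × b ≡ p g
    C₀-entries g b C₀g with g FP.≟ e | crosses? g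
    C₀-entries g _ refl | yes g≡e | _         = inj₁ (g≡e , refl)
    C₀-entries g _ refl | no g≢e  | yes cross = inj₂ (g≢e , cross , refl)

    -- p meets C₀ everywhere except at e, so |p ∩ C₀| = |C₀| - 1; a basis meeting all of C₀
    -- would re-glue e by the split block while agreeing with p on the crossing edges.
    C₀-dependent : Dependent C₀
    C₀-dependent = meet p C₀ , ((p , p-basis , refl) , rank-bound) , subst (meet p C₀ <_) (sym size≡) ≤-refl
      where
        size≡ : size C₀ ≡ suc (meet p C₀)
        size≡ = count-one-more (λ f → memB (C₀ f) (p f)) (λ f → isJust (C₀ f)) e
          (trans (cong (λ w → memB w (p e)) C₀-e) (≢⇒eqB≡false splitBlock (p e) splitBlock≢b₀))
          (cong isJust C₀-e) agree-off-e
          where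
            agree-off-e : ∀ i → i ≢ e → memB (C₀ i) (p i) ≡ isJust (C₀ i)
            agree-off-e i i≢e = by-cases (crosses? i)
              where
                by-cases : Dec (Crosses i) → memB (C₀ i) (p i) ≡ isJust (C₀ i)
                by-cases (yes cross) = trans (cong (λ w → memB w (p i)) (C₀-crossing i i≢e cross))
                                      (trans (eqB-refl (p i)) (sym (cong isJust (C₀-crossing i i≢e cross))))
                by-cases (no ¬cross) = trans (cong (λ w → memB w (p i)) (C₀-other i i≢e ¬cross))
                                      (sym (cong isJust (C₀-other i i≢e ¬cross)))
        rank-bound : ∀ B → InQ G B → meet B C₀ ≤ meet p C₀
        rank-bound B B-basis with meet B C₀ ≤? meet p C₀
        ... | yes ≤r = ≤r
        ... | no  ≰r = ⊥-elim (split-not-basis′ B B-basis (contains e splitBlock C₀-e)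
                                 (λ g g≢e cross → contains g (p g) (C₀-crossing g g≢e cross)))
          where
            memB⇒isJust : ∀ s b → memB s b ≡ true → isJust s ≡ true
            memB⇒isJust (just _) b _ = refl
            full : ∀ i → isJust (C₀ i) ≡ true → memB (C₀ i) (B i) ≡ true
            full = count-saturated (λ f → memB (C₀ f) (B f)) (λ f → isJust (C₀ f)) (λ i → memB⇒isJust (C₀ i) (B i))
                     (subst (_≤ meet B C₀) (sym size≡) (≰⇒> ≰r))
            contains : ∀ i b → C₀ i ≡ just b → B i ≡ b
            contains i b C₀i = sym (eqB⇒≡ b (B i) (trans (sym (cong (λ w → memB w (B i)) C₀i)) (full i (cong isJust C₀i))))

    C₀-minimal : ∀ S → S ⊆ C₀ → Dependent S → C₀ ⊆ S
    C₀-minimal S S⊆C₀ S-dep g b C₀g with S g in Sg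
    ... | just b′ = cong just (just-injective (trans (sym (S⊆C₀ g b′ Sg)) C₀g))
    ... | nothing with C₀-entries g b C₀g
    ...   | inj₁ (refl , _) = ⊥-elim (⊆p⇒independent S S⊆p S-dep)
      where
        S⊆p : ∀ f b → S f ≡ just b → b ≡ p f
        S⊆p f b Sf with C₀-entries f b (S⊆C₀ f b Sf)
        ... | inj₁ (refl , _)      = ⊥-elim (nothing≢just (trans (sym Sg) Sf))
        ... | inj₂ (_ , _ , b≡pf) = b≡pf
    ...   | inj₂ (g≢e , cross , _) = ⊥-elim (⊆switched⇒independent S g g≢e cross Sg entries S-dep)
      where
        entries : ∀ f b → S f ≡ just b → f ≢ g → f ≡ e × b ≡ splitBlock ⊎ f ≢ e × b ≡ p f
        entries f b Sf _ with C₀-entries f b (S⊆C₀ f b Sf)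
        ... | inj₁ e-entry              = inj₁ e-entry
        ... | inj₂ (f≢e , _ , b≡pf) = inj₂ (f≢e , b≡pf)

    C₀-fundamental : IsFundCircuit p e C₀
    C₀-fundamental = (C₀-dependent , C₀-minimal) , in-B∪ωₑ
      where
        in-B∪ωₑ : InBω p e C₀
        in-B∪ωₑ f b C₀f with C₀-entries f b C₀f
        ... | inj₁ (f≡e , _)       = inj₁ f≡e
        ... | inj₂ (_ , _ , b≡pf) = inj₂ b≡pf

    outside-e : ∀ C → InBω p e C → ∀ f b → C f ≡ just b → f ≢ e → b ≡ p f
    outside-e C C⊆B∪ωₑ f b Cf f≢e = [ (λ f≡e → ⊥-elim (f≢e f≡e)) , (λ b≡pf → b≡pf) ]′ (C⊆B∪ωₑ f b Cf)

    fundamental-e : ∀ C → IsFundCircuit p e C → C e ≡ just splitBlock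
    fundamental-e C ((C-dep , _) , C⊆B∪ωₑ) with C e in Ce
    ... | nothing = ⊥-elim (⊆p⇒independent C C⊆p C-dep)
      where
        C⊆p : ∀ f b → C f ≡ just b → b ≡ p f
        C⊆p f b Cf with C⊆B∪ωₑ f b Cf
        ... | inj₁ refl = ⊥-elim (nothing≢just (trans (sym Ce) Cf))
        ... | inj₂ b≡pf = b≡pf
    ... | just c with c ≟B p e | c ≟B keepBlock
    ...   | yes c≡pe | _ = ⊥-elim (⊆p⇒independent C C⊆p C-dep)
      where
        C⊆p : ∀ f b → C f ≡ just b → b ≡ p f
        C⊆p f b Cf with C⊆B∪ωₑ f b Cf
        ... | inj₁ refl = trans (just-injective (trans (sym Cf) Ce)) c≡pe
        ... | inj₂ b≡pf = b≡pf
    ...   | no _ | yes c≡keep = ⊥-elim (⊆basis⇒independent (InQ G) (update p e keepBlock) C kept-basis C⊆kept C-dep)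
      where
        C⊆kept : ∀ f b → C f ≡ just b → update p e keepBlock f ≡ b
        C⊆kept f b Cf = by-cases (f FP.≟ e)
          where
            by-cases : Dec (f ≡ e) → update p e keepBlock f ≡ b
            by-cases (yes f≡e) = trans (cong (update p e keepBlock) f≡e) (trans (update-at p e keepBlock)
              (trans (sym c≡keep) (just-injective (trans (sym Ce) (trans (cong C (sym f≡e)) Cf)))))
            by-cases (no f≢e) = trans (update-≢ p e keepBlock f f≢e) (sym (outside-e C C⊆B∪ωₑ f b Cf f≢e))
    ...   | no c≢pe | no c≢keep = cong just (remaining-block c c≢pe c≢keep)

    fundamental-crossing : ∀ C → IsFundCircuit p e C → ∀ g → g ≢ e → Crosses g → C g ≡ just (p g)
    fundamental-crossing C fc@((C-dep , _) , C⊆B∪ωₑ) g g≢e cross with C g in Cg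
    ... | just b = cong just (outside-e C C⊆B∪ωₑ g b Cg g≢e)
    fundamental-crossing C fc@((C-dep , _) , C⊆B∪ωₑ) g g≢e cross | nothing =
      ⊥-elim (⊆switched⇒independent C g g≢e cross Cg entries C-dep)
      where
        entries : ∀ f b → C f ≡ just b → f ≢ g → f ≡ e × b ≡ splitBlock ⊎ f ≢ e × b ≡ p f
        entries f b Cf _ with f FP.≟ e
        ... | yes refl = inj₁ (refl , just-injective (trans (sym Cf) (fundamental-e C fc)))
        ... | no f≢e   = inj₂ (f≢e , outside-e C C⊆B∪ωₑ f b Cf f≢e)

    fundamental⇒crossing : ∀ C → IsFundCircuit p e C → ∀ g b → C g ≡ just b → g ≢ e → Crosses g
    fundamental⇒crossing C fc@((_ , C-minimal) , _) g b Cg g≢e with C₀-entries g b (C-minimal C₀ C₀⊆C C₀-dependent g b Cg)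
      where
        C₀⊆C : C₀ ⊆ C
        C₀⊆C f b′ C₀f with C₀-entries f b′ C₀f
        ... | inj₁ (refl , refl)          = fundamental-e C fc
        ... | inj₂ (f≢e , cross , refl) = fundamental-crossing C fc f f≢e cross
    ... | inj₁ (g≡e , _)       = ⊥-elim (g≢e g≡e)
    ... | inj₂ (_ , cross , _) = cross

    crossing⇒interlaced : ∀ f → Crosses f → Interlaced G p e f
    crossing⇒interlaced f ((r , 0<r , r<k₂ , lab-r) , (s , k₂<s , s<N , lab-s)) =
      trail , at 0 0<N , at r r<N , at k₂ k₂<N , at s s<N ,
      subst₂ _<_ (sym (toℕ-at 0 0<N)) (sym (toℕ-at r r<N)) 0<r ,
      subst₂ _<_ (sym (toℕ-at r r<N)) (sym (toℕ-at k₂ k₂<N)) r<k₂ ,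
      subst₂ _<_ (sym (toℕ-at k₂ k₂<N)) (sym (toℕ-at s s<N)) k₂<s ,
      inj₁ (label-at 0 0<N lab-0 , label-at r r<N lab-r , label-at k₂ k₂<N lab-k₂ , label-at s s<N lab-s)
      where
        open TourTrail T
        0<N : 0 < N
        0<N = <-trans 0<k₂ k₂<N
        r<N : r < N
        r<N = <-trans r<k₂ k₂<N
        at : ∀ n → n < N → Fin (suc len)
        at n n<N = fromℕ< (subst (n <_) (sym 1+len≡N) n<N)
        toℕ-at : ∀ n n<N → toℕ (at n n<N) ≡ n
        toℕ-at n n<N = toℕ-fromℕ< _
        label-at : ∀ {g} n n<N → label G p (arc n) ≡ just g → label G p (arc (toℕ (at n n<N))) ≡ just g
        label-at n n<N lab = trans (cong (λ w → label G p (arc w)) (toℕ-at n n<N)) lab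

    -- Along any other curve through e, the split block is the same, since it is the block of e
    -- that is neither p e nor the keep block. If f were interlaced there but not crossing here,
    -- switching e and f would be a basis by the other curve and not one by this curve.
    module OtherTour (T′ : Tour p) (f : Fin E) (f≢e : f ≢ e) (i j r s : ℕ)
        (i<r : i < r) (r<j : r < j) (j<s : j < s) (s<N+i : s < Tour.N T′ + i)
        (lab-i : label G p (Tour.arc T′ i) ≡ just e) (lab-j : label G p (Tour.arc T′ j) ≡ just e)
        (lab-r : label G p (Tour.arc T′ r) ≡ just f) (lab-s : label G p (Tour.arc T′ s) ≡ just f) where
      module V = TwoVisits T′ e i j (<-trans i<r r<j) (<-trans j<s s<N+i) lab-i lab-j

      same-split : V.splitBlock ≡ splitBlock
      same-split = remaining-block V.splitBlock V.splitBlock≢b₀ λ split≡keep →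
        V.split-not-basis q (update-at p e V.splitBlock) (λ g g≢e → inj₁ (update-≢ p e V.splitBlock g g≢e))
          (keep-basis q (trans (update-at p e V.splitBlock) split≡keep) (update-≢ p e V.splitBlock) p-basis)
        where q = update p e V.splitBlock

      crossing : Crosses f
      crossing with crosses? f
      ... | yes cross   = cross
      ... | no ¬cross = ⊥-elim (split-not-basis′ (switched f) switched-f-basis (switched-e f f≢e)
                          λ g g≢e cross → switched-other f g g≢e λ { refl → ¬cross cross })
        where
          switched-f-basis : InQ G (switched f)
          switched-f-basis = V.SplitAndSwitch.split-and-switch-basis f f≢e r s i<r r<j j<s s<N+i lab-r lab-s (switched f)
            (trans (switched-e f f≢e) (sym same-split))
            (λ eq → anotherBlock-≢ (p f) (trans (sym (update-at _ f _)) eq)) (λ h h≢e h≢f → switched-other f h h≢e h≢f)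
            p-basis

    interlaced⇒crossing : ∀ f → f ≢ e → Interlaced G p e f → Crosses f
    interlaced⇒crossing f f≢e (tr , i , j , k , l , i<j , j<k , k<l , order) = from-pattern order
      where
        open TrailTour p tr
        open ClosedTrail tr using (len) renaming (arc to trail-arc)
        T′ : Tour p
        T′ = TrailTour.tour p tr
        label-on : ∀ {g} (x : Fin (suc len)) → label G p (trail-arc x) ≡ just g → label G p (Tour.arc T′ (toℕ x)) ≡ just g
        label-on x lab = trans (cong (λ w → label G p (trail-arc w)) (position-toℕ x)) lab
        l<N+i : toℕ l < suc len + toℕ i
        l<N+i = ≤-trans (toℕ<n l) (m≤m+n (suc len) (toℕ i))
        from-pattern : _ → Crosses f
        from-pattern (inj₁ (li , lj , lk , ll)) =
          OtherTour.crossing T′ f f≢e (toℕ i) (toℕ k) (toℕ j) (toℕ l) i<j j<k k<l l<N+i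
            (label-on i li) (label-on k lk) (label-on j lj) (label-on l ll)
        from-pattern (inj₂ (li , lj , lk , ll)) =
          OtherTour.crossing T′ f f≢e (toℕ j) (toℕ l) (toℕ k) (suc len + toℕ i) j<k k<l l<N+i (+-monoʳ-< (suc len) i<j)
            (label-on j lj) (label-on l ll) (label-on k lk)
            (trans (cong (label G p) (Tour.arc-periodic T′ (toℕ i))) (label-on i li))

    interlaced⇔meets : ∀ f → e ≢ f → Interlaced G p e f ⇔ FundCircuitMeets p e f
    interlaced⇔meets f e≢f = mk⇔
      (λ il → C₀ , C₀-fundamental , p f , C₀-crossing f f≢e (interlaced⇒crossing f f≢e il))
      (λ { (C , fc , b , Cf) → crossing⇒interlaced f (fundamental⇒crossing C fc f b Cf f≢e) })
      where
        f≢e : f ≢ e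
        f≢e f≡e = e≢f (sym f≡e)

    active⇔active : (_≺_ : Rel (Fin E) 0ℓ) → IsStrictTotalOrder _≡_ _≺_ →
      EdgeActive G p _≺_ e ⇔ ClassActive _≺_ p e
    active⇔active _≺_ ≺-order = mk⇔ to from
      where
        open IsStrictTotalOrder ≺-order using (compare; irrefl; asym)
        to : EdgeActive G p _≺_ e → ClassActive _≺_ p e
        to active = C₀ , C₀-fundamental , (splitBlock , C₀-e) , λ f b C₀f → least f (C₀-entries f b C₀f)
          where
            least : ∀ f {b} → f ≡ e × b ≡ splitBlock ⊎ f ≢ e × Crosses f × b ≡ p f → f ≡ e ⊎ e ≺ f
            least f (inj₁ (f≡e , _)) = inj₁ f≡e
            least f (inj₂ (_ , cross , _)) with compare f e
            ... | tri< f≺e _ _ = ⊥-elim (active f f≺e (crossing⇒interlaced f cross))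
            ... | tri≈ _ f≡e _ = inj₁ f≡e
            ... | tri> _ _ e≺f = inj₂ e≺f
        from : ClassActive _≺_ p e → EdgeActive G p _≺_ e
        from (C , fc , _ , least) f f≺e il
          with least f (p f) (fundamental-crossing C fc f f≢e (interlaced⇒crossing f f≢e il))
          where
            f≢e : f ≢ e
            f≢e refl = irrefl refl f≺e
        ... | inj₁ refl = irrefl refl f≺e
        ... | inj₂ e≺f  = asym f≺e e≺f

lemma6p8 : (G : RibbonGraph) (p : Partition G) → InQ G p →
    (∀ e f → e ≢ f → Interlaced G p e f ⇔ ZG.FundCircuitMeets G p e f) ×
    ((_≺_ : Rel (Fin (nE G)) 0ℓ) → IsStrictTotalOrder _≡_ _≺_ →
      ∀ e → EdgeActive G p _≺_ e ⇔ ZG.ClassActive G _≺_ p e)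
lemma6p8 G p p-basis =
  (λ e f → ForEdge.interlaced⇔meets p p-basis e f) ,
  (λ _≺_ ≺-order e → ForEdge.active⇔active p p-basis e _≺_ ≺-order)
  where open FundamentalCircuit G
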